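{- The integrality gap of the integer program $$\text{Minimize } \sum_{e \in E(T_1)} x_e \quad \text{s.t. } \sum_{e \in L(Q)} x_e \ge 1 \ \ \forall Q \in \mathcal{Q}, \qquad x_e \in \{0,1\}\ \ \forall e \in E(T_1)$$ (with respect to its LP relaxation, in which $x_e \in\{0,1\}$ is replaced by $x_e \ge 0$) is at least $4 - o(1)$, even when restricted to inputs $\mathcal{T}$ consisting of two trees: there is an infinite family of pairs $\mathcal{T}=\{T_1,T_2\}$ with $n=|X|$ unbounded such that the ratio of the optimal integral value to the optimal LP value is at least $4 - o(1)$ as $n \to \infty$.
   Context: The input is a set $\mathcal{T}=\{T_1,\dots,T_t\}$ of unrooted binary phylogenetic trees on a common leaf set $X$: trees whose internal vertices have degree 3 and whose leaves are bijectively labelled by $X$. For $Y\subseteq X$, $T[Y]$ is the minimal subtree connecting $Y$, and $T|_Y$ is $T[Y]$ with degree-2 vertices suppressed; trees on the same labels are isomorphic ($\cong$) if there is a label-preserving graph isomorphism. A quartet is a 4-element subset of $X$; for $Q = \{a,b,c,d\}$, $ab|cd$ is the tree on $Q$ where $a,b$ share a neighbour, $c,d$ share a neighbour, and these two neighbours are adjacent. If $T_1|_Q \cong ab|cd$, $L(Q)$ is the edge set of $T_1[\{a,b\}] \cup T_1[\{c,d\}]$. $\mathcal{Q}$ is the set of quartets $Q$ such that $T_1|_Q \not\cong T_i|_Q$ for some $2 \le i \le t$. The integrality gap is the supremum over inputs of the ratio between the optimal value of the integer program and the optimal value of its LP relaxation. -}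

module Defs where

open import Data.Nat using (ℕ; zero; suc; _+_; _≤_)
open import Data.Fin using (Fin; _≟_)
open import Data.List using (List; []; _∷_; length; filter; foldr; map; allFin)
open import Data.List.Relation.Unary.Unique.Propositional using (Unique)
open import Data.List.Membership.Propositional using (_∈_)
open import Data.Product using (Σ; ∃; _×_; _,_; proj₁; proj₂)
open import Data.Sum using (_⊎_)
open import Relation.Nullary using (¬_)
open import Relation.Nullary.Decidable using (_⊎-dec_)
open import Relation.Binary.PropositionalEquality using (_≡_; _≢_)
open import Data.Rational using (ℚ; 0ℚ; 1ℚ; _+_; _≤_)

module _ {V m : ℕ} (ends : Fin m → Fin V × Fin V) where

  Joins : Fin m → Fin V → Fin V → Set
  Joins e u v = ends e ≡ (u , v) ⊎ ends e ≡ (v , u)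

  data Walk : Fin V → Fin V → List (Fin V) → List (Fin m) → Set where
    here : ∀ u → Walk u u (u ∷ []) []
    step : ∀ {u v w vs es} (e : Fin m) → Joins e u v → Walk v w vs es →
           Walk u w (u ∷ vs) (e ∷ es)

  Path : Fin V → Fin V → List (Fin V) → List (Fin m) → Set
  Path u w vs es = Walk u w vs es × Unique vs

  -- degree of a vertex (the graph will be loopless)
  deg : Fin V → ℕ
  deg v = length (filter (λ e → (proj₁ (ends e) ≟ v) ⊎-dec (proj₂ (ends e) ≟ v)) (allFin m))

record BinPhyloTree (n : ℕ) : Set where
  field
    V m       : ℕ
    ends      : Fin m → Fin V × Fin V
    loopless  : ∀ e → proj₁ (ends e) ≢ proj₂ (ends e)
    simple    : ∀ e f u v → Joins ends e u v → Joins ends f u v → e ≡ f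
    connected : ∀ u w → ∃ λ vs → ∃ λ es → Walk ends u w vs es
    edgeCount : suc m ≡ V                 -- connected + |E| = |V|-1 : a tree
    leaf      : Fin n → Fin V
    leafInj   : ∀ i j → leaf i ≡ leaf j → i ≡ j
    degrees   : ∀ v → (deg ends v ≡ 1 × ∃ λ i → leaf i ≡ v)
                    ⊎ (deg ends v ≡ 3 × ¬ (∃ λ i → leaf i ≡ v))

open BinPhyloTree public

LeafPath : ∀ {n} (T : BinPhyloTree n) → Fin n → Fin n →
           List (Fin (V T)) → List (Fin (m T)) → Set
LeafPath T a b = Path (ends T) (leaf T a) (leaf T b)

-- T|_{a,b,c,d} ≅ ab|cd  :  T[{a,b}] and T[{c,d}] are vertex-disjoint
Displays : ∀ {n} (T : BinPhyloTree n) → Fin n → Fin n → Fin n → Fin n → Set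
Displays T a b c d =
  ∀ vs es vs' es' → LeafPath T a b vs es → LeafPath T c d vs' es' →
  ∀ v → v ∈ vs → ¬ (v ∈ vs')

Distinct4 : ∀ {n} → Fin n → Fin n → Fin n → Fin n → Set
Distinct4 a b c d = a ≢ b × a ≢ c × a ≢ d × b ≢ c × b ≢ d × c ≢ d

-- Q = {a,b,c,d} ∈ 𝒬 with T₁|_Q ≅ ab|cd (and T₂|_Q ≇ ab|cd)
InQ : ∀ {n} (T₁ T₂ : BinPhyloTree n) → Fin n → Fin n → Fin n → Fin n → Set
InQ T₁ T₂ a b c d = Distinct4 a b c d × Displays T₁ a b c d × ¬ Displays T₂ a b c d

sumℚ : List ℚ → ℚ
sumℚ = foldr Data.Rational._+_ 0ℚ

objective : ∀ {n} (T : BinPhyloTree n) → (Fin (m T) → ℚ) → ℚ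
objective T x = sumℚ (map x (allFin (m T)))

-- covering constraints:  Σ_{e ∈ L(Q)} x_e ≥ 1 for all Q ∈ 𝒬,
-- where L(Q) = E(T₁[{a,b}]) ∪ E(T₁[{c,d}]) (a disjoint union here)
Covers : ∀ {n} (T₁ T₂ : BinPhyloTree n) → (Fin (m T₁) → ℚ) → Set
Covers T₁ T₂ x = ∀ a b c d → InQ T₁ T₂ a b c d →
  ∀ vs es vs' es' → LeafPath T₁ a b vs es → LeafPath T₁ c d vs' es' →
  1ℚ Data.Rational.≤ sumℚ (map x es) Data.Rational.+ sumℚ (map x es')

IPFeasible : ∀ {n} (T₁ T₂ : BinPhyloTree n) → (Fin (m T₁) → ℚ) → Set
IPFeasible T₁ T₂ x = (∀ e → x e ≡ 0ℚ ⊎ x e ≡ 1ℚ) × Covers T₁ T₂ x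

LPFeasible : ∀ {n} (T₁ T₂ : BinPhyloTree n) → (Fin (m T₁) → ℚ) → Set
LPFeasible T₁ T₂ y = (∀ e → 0ℚ Data.Rational.≤ y e) × Covers T₁ T₂ y

-- Take n = s² leaves, let T₁ be the caterpillar listing them as 0, 1, …, n − 1 and T₂ the caterpillar
-- listing them in the order of the transposed s × s grid (r s + j ↦ j s + r). For rows r < r′ and columns
-- i, i′ < j, T₁ displays (r s + i)(r s + j) | (r′ s + i′)(r′ s + j), whereas in T₂ the two paths meet.
--
-- Weight ¼ on each pendant edge of T₁ is LP-feasible, since a path between two leaves uses two pendant edges;
-- its value is n / 4. For an integral solution x, call leaves j < k a free pair if their path avoids x.
-- Scanning the leaves in order, every leaf but two is paid for by a chosen pendant edge, a chosen spine edge,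
-- or by closing a free pair. A free pair closing in row r either starts in the same row, which
-- for each column happens in at most one row (two such pairs would form a quartet of 𝒬 missed by x), or starts
-- in an earlier row, which happens at most once per row. So n ≤ |x| + 2s + 2, and |x| / (n / 4) → 4.

module Submission where

open import Data.Nat using (ℕ; NonZero)
import Data.Nat as ℕ
open import Data.Bool using (Bool)
open import Data.Fin using (Fin)
open import Data.Product using (_×_)

module Counting where

  open import Data.Nat
  open import Data.Nat.Properties
  open import Data.Bool using (Bool; true; false)
  open import Data.Empty using (⊥; ⊥-elim)
  open import Data.Sum using (inj₁; inj₂)
  open import Relation.Nullary.Decidable using (dec-true; dec-false)
  open import Relation.Binary.PropositionalEquality
  open import Data.Nat.Tactic.RingSolver using (solve-∀)
  open import Data.Fin using (Fin; toℕ)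
  import Data.Fin as Fin
  open import Data.List using (length; filter; tabulate)
  open import Relation.Nullary using (Dec; does)
  open import Function using (_∘_)

  Σ< : (ℕ → ℕ) → ℕ → ℕ
  Σ< f zero = 0
  Σ< f (suc n) = f 0 + Σ< (λ i → f (suc i)) n

  𝟙 : Bool → ℕ
  𝟙 true = 1
  𝟙 false = 0

  count : (ℕ → Bool) → ℕ → ℕ
  count p = Σ< (λ i → 𝟙 (p i))

  𝟙≤1 : ∀ b → 𝟙 b ≤ 1
  𝟙≤1 false = z≤n
  𝟙≤1 true = s≤s z≤n

  Σ<-last : ∀ f n → Σ< f (suc n) ≡ Σ< f n + f n
  Σ<-last f zero = +-comm (f 0) 0
  Σ<-last f (suc n) = trans (cong (f 0 +_) (Σ<-last (λ i → f (suc i)) n)) (sym (+-assoc (f 0) _ _))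

  count-last : ∀ p n → count p (suc n) ≡ count p n + 𝟙 (p n)
  count-last p = Σ<-last (λ i → 𝟙 (p i))

  Σ<-cong : ∀ {f h} n → (∀ i → i < n → f i ≡ h i) → Σ< f n ≡ Σ< h n
  Σ<-cong zero eq = refl
  Σ<-cong (suc n) eq = cong₂ _+_ (eq 0 z<s) (Σ<-cong n (λ i lt → eq (suc i) (s<s lt)))

  Σ<-mono : ∀ {f h} n → (∀ i → i < n → f i ≤ h i) → Σ< f n ≤ Σ< h n
  Σ<-mono zero le = z≤n
  Σ<-mono (suc n) le = +-mono-≤ (le 0 z<s) (Σ<-mono n (λ i lt → le (suc i) (s<s lt)))

  Σ<-zero : ∀ {f} n → (∀ i → i < n → f i ≡ 0) → Σ< f n ≡ 0
  Σ<-zero zero _ = refl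
  Σ<-zero (suc n) eq rewrite eq 0 z<s = Σ<-zero n (λ i lt → eq (suc i) (s<s lt))

  Σ<-const-1 : ∀ n → Σ< (λ _ → 1) n ≡ n
  Σ<-const-1 zero = refl
  Σ<-const-1 (suc n) = cong suc (Σ<-const-1 n)

  Σ<-+ : ∀ f h n → Σ< (λ i → f i + h i) n ≡ Σ< f n + Σ< h n
  Σ<-+ f h zero = refl
  Σ<-+ f h (suc n) rewrite Σ<-+ (λ i → f (suc i)) (λ i → h (suc i)) n =
    interchange (f 0) (h 0) (Σ< (λ i → f (suc i)) n) (Σ< (λ i → h (suc i)) n)
    where
    interchange : ∀ a b c d → a + b + (c + d) ≡ a + c + (b + d)
    interchange = solve-∀

  Σ<-split : ∀ f a b → Σ< f (a + b) ≡ Σ< f a + Σ< (λ i → f (a + i)) b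
  Σ<-split f zero b = refl
  Σ<-split f (suc a) b = trans (cong (f 0 +_) (Σ<-split (λ i → f (suc i)) a b)) (sym (+-assoc (f 0) _ _))

  Σ<-swap : ∀ (f : ℕ → ℕ → ℕ) a b → Σ< (λ i → Σ< (f i) b) a ≡ Σ< (λ j → Σ< (λ i → f i j) a) b
  Σ<-swap f zero b = sym (Σ<-zero b (λ _ _ → refl))
  Σ<-swap f (suc a) b = begin
      Σ< (f 0) b + Σ< (λ i → Σ< (f (suc i)) b) a
    ≡⟨ cong (Σ< (f 0) b +_) (Σ<-swap (λ i → f (suc i)) a b) ⟩
      Σ< (f 0) b + Σ< (λ j → Σ< (λ i → f (suc i) j) a) b
    ≡⟨ Σ<-+ (f 0) (λ j → Σ< (λ i → f (suc i) j) a) b ⟨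
      Σ< (λ j → f 0 j + Σ< (λ i → f (suc i) j) a) b ∎
    where open ≡-Reasoning

  Σ<-rows : ∀ f s R → Σ< f (R * s) ≡ Σ< (λ r → Σ< (λ c → f (r * s + c)) s) R
  Σ<-rows f s zero = refl
  Σ<-rows f s (suc R) = begin
      Σ< f (s + R * s)
    ≡⟨ Σ<-split f s (R * s) ⟩
      Σ< f s + Σ< (λ i → f (s + i)) (R * s)
    ≡⟨ cong (Σ< f s +_) (Σ<-rows (λ i → f (s + i)) s R) ⟩
      Σ< f s + Σ< (λ r → Σ< (λ c → f (s + (r * s + c))) s) R
    ≡⟨ cong (Σ< f s +_) (Σ<-cong R (λ r _ → Σ<-cong s (λ c _ → cong f (sym (+-assoc s (r * s) c))))) ⟩
      Σ< f s + Σ< (λ r → Σ< (λ c → f (s + r * s + c)) s) R ∎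
    where open ≡-Reasoning

  count-atMostOne : ∀ p n → (∀ i j → i < j → j < n → p i ≡ true → p j ≡ true → ⊥) → count p n ≤ 1
  count-atMostOne p zero _ = z≤n
  count-atMostOne p (suc n) unique rewrite count-last p n with p n in pn
  ... | false = subst (_≤ 1) (sym (+-identityʳ _)) (count-atMostOne p n (λ i j i<j j<n → unique i j i<j (m<n⇒m<1+n j<n)))
  ... | true = subst (_≤ 1) (cong (_+ 1) (sym (Σ<-zero n earlier-false))) ≤-refl
    where
    earlier-false : ∀ i → i < n → 𝟙 (p i) ≡ 0
    earlier-false i i<n with p i in pi
    ... | false = refl
    ... | true = ⊥-elim (unique i n i<n ≤-refl pi pn)

  ≡ᵇ-refl : ∀ a → (a ≡ᵇ a) ≡ true
  ≡ᵇ-refl a = dec-true (a ≟ a) refl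

  ≢⇒≡ᵇ≡false : ∀ {i a} → i ≢ a → (i ≡ᵇ a) ≡ false
  ≢⇒≡ᵇ≡false {i} {a} = dec-false (i ≟ a)

  count-≡ᵇ-absent : ∀ k a → k ≤ a → count (_≡ᵇ a) k ≡ 0
  count-≡ᵇ-absent k a k≤a = Σ<-zero k (λ i i<k → cong 𝟙 (≢⇒≡ᵇ≡false {i} {a} (λ { refl → <⇒≱ i<k k≤a })))

  count-≡ᵇ-present : ∀ k a → a < k → count (_≡ᵇ a) k ≡ 1
  count-≡ᵇ-present (suc k) a a<1+k rewrite count-last (_≡ᵇ a) k with m≤n⇒m<n∨m≡n (s≤s⁻¹ a<1+k)
  ... | inj₁ a<k rewrite count-≡ᵇ-present k a a<k | ≢⇒≡ᵇ≡false {k} {a} (>⇒≢ a<k) = refl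
  ... | inj₂ refl rewrite count-≡ᵇ-absent k k ≤-refl | ≡ᵇ-refl k = refl

  length-filter-tabulate : ∀ {A : Set} {P : A → Set} (P? : ∀ a → Dec (P a)) {k} (f : Fin k → A) (q : ℕ → Bool) →
                           (∀ j → does (P? (f j)) ≡ q (toℕ j)) → length (filter P? (tabulate f)) ≡ count q k
  length-filter-tabulate P? {zero} f q _ = refl
  length-filter-tabulate P? {suc k} f q eq with does (P? (f Fin.zero)) | eq Fin.zero
  ... | true  | q0 rewrite sym q0 = cong suc (length-filter-tabulate P? (f ∘ Fin.suc) (q ∘ suc) (eq ∘ Fin.suc))
  ... | false | q0 rewrite sym q0 = length-filter-tabulate P? (f ∘ Fin.suc) (q ∘ suc) (eq ∘ Fin.suc)

-- Leaves 0, 1, … sit in rows of length s. p k: the pendant edge of leaf k is covered;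
-- g k: the edge separating leaves ≤ k from leaves > k is covered.
module FreePairs (s : ℕ) (p g : ℕ → Bool) where

  open import Data.Nat
  open import Data.Nat.Properties
  open import Data.Bool as Bool using (Bool; true; false; not; _∧_; _∨_)
  open import Data.Product using (∃; _×_; _,_)
  open import Data.Sum using (inj₁; inj₂)
  open import Data.Empty using (⊥; ⊥-elim)
  open import Relation.Binary.PropositionalEquality
  open import Relation.Nullary using (Dec; yes; no; does)
  open import Relation.Nullary.Decidable using (_×-dec_; _→-dec_; dec-true)
  open import Data.Nat.Tactic.RingSolver using (solve-∀)
  open Counting

  Gapless : ℕ → ℕ → Set
  Gapless j k = ∀ {i} → i < k → j ≤ i → g i ≡ false

  Free : ℕ → ℕ → Set
  Free j k = p j ≡ false × p k ≡ false × Gapless j k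

  free? : ∀ j k → Dec (Free j k)
  free? j k = p j Bool.≟ false ×-dec p k Bool.≟ false ×-dec
              allUpTo? (λ i → j ≤? i →-dec g i Bool.≟ false) k

  free-shrink : ∀ {j j′ k} → Free j k → j ≤ j′ → p j′ ≡ false → Free j′ k
  free-shrink (_ , pk , gapless) j≤j′ pj′ = pj′ , pk , λ i<k j′≤i → gapless i<k (≤-trans j≤j′ j′≤i)

  live : ℕ → Bool
  live zero = not (p 0)
  live (suc k) = not (p (suc k)) ∨ (not (g k) ∧ live k)

  closes : ℕ → Bool
  closes zero = false
  closes (suc k) = not (p (suc k)) ∧ (not (g k) ∧ live k)

  -- `live k` is a potential: each step from k to k + 1 is paid for by a covered pendant,
  -- a covered gap, a newly closed free pair, or by `live` switching on.
  scan-bound : ∀ K → K ≤ count p (suc K) + count g K + count closes (suc K) + 𝟙 (live K)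
  scan-bound zero = z≤n
  scan-bound (suc K) = begin
      suc K
    ≤⟨ s≤s (scan-bound K) ⟩
      suc (P + G + C + 𝟙 o)
    ≡⟨ +-suc (P + G + C) (𝟙 o) ⟨
      P + G + C + suc (𝟙 o)
    ≤⟨ +-monoʳ-≤ (P + G + C) (step (p (suc K)) (g K) o) ⟩
      P + G + C + (𝟙 (p (suc K)) + 𝟙 (g K) + 𝟙 (closes (suc K)) + 𝟙 (live (suc K)))
    ≡⟨ rearrange P G C (𝟙 (p (suc K))) (𝟙 (g K)) (𝟙 (closes (suc K))) (𝟙 (live (suc K))) ⟩
      (P + 𝟙 (p (suc K))) + (G + 𝟙 (g K)) + (C + 𝟙 (closes (suc K))) + 𝟙 (live (suc K))
    ≡⟨ cong₃ (λ x y z → x + y + z + 𝟙 (live (suc K)))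
             (count-last p (suc K)) (count-last g K) (count-last closes (suc K)) ⟨
      count p (suc (suc K)) + count g (suc K) + count closes (suc (suc K)) + 𝟙 (live (suc K)) ∎
    where
    open ≤-Reasoning
    P G C : ℕ
    P = count p (suc K)
    G = count g K
    C = count closes (suc K)
    o : Bool
    o = live K
    step : ∀ a b o → suc (𝟙 o) ≤ 𝟙 a + 𝟙 b + 𝟙 (not a ∧ (not b ∧ o)) + 𝟙 (not a ∨ (not b ∧ o))
    step true  true  false = s≤s z≤n
    step true  true  true  = s≤s (s≤s z≤n)
    step true  false false = s≤s z≤n
    step true  false true  = s≤s (s≤s z≤n)
    step false true  false = s≤s z≤n
    step false true  true  = s≤s (s≤s z≤n)
    step false false false = s≤s z≤n
    step false false true  = s≤s (s≤s z≤n)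
    rearrange : ∀ A B C x y z w → A + B + C + (x + y + z + w) ≡ (A + x) + (B + y) + (C + z) + w
    rearrange = solve-∀
    cong₃ : ∀ (f : ℕ → ℕ → ℕ → ℕ) {a b c a′ b′ c′} → a ≡ a′ → b ≡ b′ → c ≡ c′ → f a b c ≡ f a′ b′ c′
    cong₃ f refl refl refl = refl

  gapless-extend : ∀ {j k} → Gapless j k → g k ≡ false → Gapless j (suc k)
  gapless-extend gapless gk i<1+k j≤i with m≤n⇒m<n∨m≡n (s≤s⁻¹ i<1+k)
  ... | inj₁ i<k = gapless i<k j≤i
  ... | inj₂ refl = gk

  live⇒gapless : ∀ k → live k ≡ true → ∃ λ j → j ≤ k × p j ≡ false × Gapless j k
  live⇒gapless zero _ with p 0 in p0
  ... | false = 0 , z≤n , p0 , λ ()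
  live⇒gapless (suc k) _ with p (suc k) in pk | g k in gk | live k in lk
  ... | false | _ | _ = suc k , ≤-refl , pk , λ i<k k<i → ⊥-elim (<-irrefl refl (<-≤-trans i<k k<i))
  ... | true | false | true with live⇒gapless k lk
  ...   | j , j≤k , pj , gapless = j , m≤n⇒m≤1+n j≤k , pj , gapless-extend gapless gk

  closes⇒free : ∀ k → closes k ≡ true → ∃ λ j → j < k × Free j k
  closes⇒free (suc k) _ with p (suc k) | g k in gk | live k in lk
  ... | false | false | true with live⇒gapless k lk
  ...   | j , j≤k , pj , gapless = j , s≤s j≤k , pj , refl , gapless-extend gapless gk

  closes⇒uncovered : ∀ k → closes k ≡ true → p k ≡ false
  closes⇒uncovered (suc k) _ with p (suc k)
  ... | false = refl

  FreeInRow : ℕ → ℕ → Set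
  FreeInRow r c = ∃ λ ca → ca < c × Free (r * s + ca) (r * s + c)

  freeInRow? : ∀ r c → Dec (FreeInRow r c)
  freeInRow? r c = anyUpTo? (λ ca → free? (r * s + ca) (r * s + c)) c

  NoCrossing : Set
  NoCrossing = ∀ {r r′ c} → r < r′ → r′ < s → c < s → FreeInRow r c → FreeInRow r′ c → ⊥

  rowFree : ℕ → ℕ → Bool
  rowFree r c = does (freeInRow? r c)

  entersRow : ℕ → ℕ → Bool
  entersRow r c = closes (r * s + c) ∧ not (rowFree r c)

  rowFree-atMostOne : NoCrossing → ∀ {c} → c < s → count (λ r → rowFree r c) s ≤ 1
  rowFree-atMostOne noCrossing c<s = count-atMostOne _ s λ r r′ r<r′ r′<s h h′ →
    noCrossing r<r′ r′<s c<s (fromDoes (freeInRow? r _) h) (fromDoes (freeInRow? r′ _) h′)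
    where
    fromDoes : ∀ {A : Set} (a? : Dec A) → does a? ≡ true → A
    fromDoes (yes a) _ = a

  entersRow-atMostOne : ∀ r → count (entersRow r) s ≤ 1
  entersRow-atMostOne r = count-atMostOne _ s λ c₁ c₂ c₁<c₂ _ h₁ h₂ →
    let closes₁ , _ = ∧-not h₁
        closes₂ , ¬rowFree₂ = ∧-not h₂
    in  true≢false (trans (sym (dec-true (freeInRow? r c₂) (freeInRow c₁<c₂ closes₁ closes₂))) ¬rowFree₂)
    where
    ∧-not : ∀ {a b} → (a ∧ not b) ≡ true → a ≡ true × b ≡ false
    ∧-not {true} {false} _ = refl , refl
    true≢false : true ≢ false
    true≢false ()
    -- the free pair closing at c₂ starts in row r, or else it can be shortened to start at the uncovered leaf c₁
    freeInRow : ∀ {c₁ c₂} → c₁ < c₂ → closes (r * s + c₁) ≡ true → closes (r * s + c₂) ≡ true →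
                FreeInRow r c₂
    freeInRow {c₁} {c₂} c₁<c₂ h₁ h₂ with closes⇒free _ h₂
    ... | j , j<k , free with r * s ≤? j
    ...   | yes rs≤j = j ∸ r * s , +-cancelˡ-< (r * s) _ c₂ (subst (_< r * s + c₂) j≡ j<k) ,
                       subst (λ i → Free i (r * s + c₂)) j≡ free
      where
      j≡ : j ≡ r * s + (j ∸ r * s)
      j≡ = sym (m+[n∸m]≡n rs≤j)
    ...   | no rs≰j = c₁ , c₁<c₂ ,
                      free-shrink free (≤-trans (<⇒≤ (≰⇒> rs≰j)) (m≤m+n (r * s) c₁)) (closes⇒uncovered _ h₁)

  closes-bound : NoCrossing → count closes (s * s) ≤ s + s
  closes-bound noCrossing = begin
      count closes (s * s)
    ≡⟨ Σ<-rows (λ k → 𝟙 (closes k)) s s ⟩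
      Σ< (λ r → count (λ c → closes (r * s + c)) s) s
    ≤⟨ Σ<-mono s (λ r _ → Σ<-mono s (λ c _ → split (rowFree r c) (closes (r * s + c)))) ⟩
      Σ< (λ r → Σ< (λ c → 𝟙 (rowFree r c) + 𝟙 (entersRow r c)) s) s
    ≡⟨ Σ<-cong s (λ r _ → Σ<-+ _ _ s) ⟩
      Σ< (λ r → count (rowFree r) s + count (entersRow r) s) s
    ≡⟨ Σ<-+ _ _ s ⟩
      Σ< (λ r → count (rowFree r) s) s + Σ< (λ r → count (entersRow r) s) s
    ≡⟨ cong (_+ Σ< (λ r → count (entersRow r) s) s) (Σ<-swap (λ r c → 𝟙 (rowFree r c)) s s) ⟩
      Σ< (λ c → count (λ r → rowFree r c) s) s + Σ< (λ r → count (entersRow r) s) s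
    ≤⟨ +-mono-≤ (Σ<-mono s (λ c c<s → rowFree-atMostOne noCrossing c<s))
                (Σ<-mono s (λ r _ → entersRow-atMostOne r)) ⟩
      Σ< (λ _ → 1) s + Σ< (λ _ → 1) s
    ≡⟨ cong₂ _+_ (Σ<-const-1 s) (Σ<-const-1 s) ⟩
      s + s ∎
    where
    open ≤-Reasoning
    split : ∀ a b → 𝟙 b ≤ 𝟙 a + 𝟙 (b ∧ not a)
    split false false = z≤n
    split false true  = s≤s z≤n
    split true  false = z≤n
    split true  true  = s≤s z≤n

  count-bound : NoCrossing → ∀ K → suc K ≡ s * s → suc K ≤ count p (suc K) + count g K + (s + s) + 2
  count-bound noCrossing K K+1≡s² = begin
      suc K
    ≤⟨ s≤s (scan-bound K) ⟩
      suc (count p (suc K) + count g K + count closes (suc K) + 𝟙 (live K))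
    ≤⟨ s≤s (+-mono-≤ (+-monoʳ-≤ (count p (suc K) + count g K) closes≤) (𝟙≤1 (live K))) ⟩
      suc (count p (suc K) + count g K + (s + s) + 1)
    ≡⟨ +-suc _ 1 ⟨
      count p (suc K) + count g K + (s + s) + 2 ∎
    where
    open ≤-Reasoning
    closes≤ : count closes (suc K) ≤ s + s
    closes≤ = subst (λ k → count closes k ≤ s + s) (sym K+1≡s²) (closes-bound noCrossing)

module RationalBounds where

  open import Data.Nat as ℕ using (ℕ; zero; suc; z≤n)
  import Data.Nat.Properties as ℕ
  open import Data.Integer as ℤ using (+_; +[1+_])
  import Data.Integer.Properties as ℤ
  open import Data.Rational
  open import Data.Rational.Properties
  import Data.Rational.Unnormalised as ℚᵘ
  import Data.Rational.Unnormalised.Properties as ℚᵘ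
  open import Data.Nat.Coprimality using (Coprime; 1-coprimeTo)
  import Data.Nat.Coprimality as Coprime
  open import Relation.Binary.PropositionalEquality
  open import Data.Nat.Tactic.RingSolver using (solve-∀)
  open import Data.Bool using (Bool)
  open import Data.Fin as Fin using (Fin; toℕ)
  open import Data.List using (tabulate)
  open import Defs using (sumℚ)
  open Counting using (𝟙; count)

  fromℕ : ℕ → ℚ
  fromℕ zero = 0ℚ
  fromℕ (suc k) = 1ℚ + fromℕ k

  fromℕ-+ : ∀ a b → fromℕ (a ℕ.+ b) ≡ fromℕ a + fromℕ b
  fromℕ-+ zero b = sym (+-identityˡ (fromℕ b))
  fromℕ-+ (suc a) b = trans (cong (λ q → 1ℚ + q) (fromℕ-+ a b)) (sym (+-assoc 1ℚ (fromℕ a) (fromℕ b)))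

  fromℕ-* : ∀ a b → fromℕ (a ℕ.* b) ≡ fromℕ a * fromℕ b
  fromℕ-* zero b = sym (*-zeroˡ (fromℕ b))
  fromℕ-* (suc a) b = begin
      fromℕ (b ℕ.+ a ℕ.* b)
    ≡⟨ fromℕ-+ b (a ℕ.* b) ⟩
      fromℕ b + fromℕ (a ℕ.* b)
    ≡⟨ cong₂ _+_ (sym (*-identityˡ (fromℕ b))) (fromℕ-* a b) ⟩
      1ℚ * fromℕ b + fromℕ a * fromℕ b
    ≡⟨ *-distribʳ-+ (fromℕ b) 1ℚ (fromℕ a) ⟨
      (1ℚ + fromℕ a) * fromℕ b ∎
    where open ≡-Reasoning

  fromℕ-nonNeg : ∀ a → 0ℚ ≤ fromℕ a
  fromℕ-nonNeg zero = ≤-refl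
  fromℕ-nonNeg (suc a) = subst (_≤ fromℕ (suc a)) (+-identityʳ 0ℚ) (+-mono-≤ 0≤1 (fromℕ-nonNeg a))
    where
    0≤1 : 0ℚ ≤ 1ℚ
    0≤1 = *≤* (ℤ.+≤+ z≤n)

  fromℕ-mono-≤ : ∀ {a b} → a ℕ.≤ b → fromℕ a ≤ fromℕ b
  fromℕ-mono-≤ {a} {b} a≤b = begin
      fromℕ a
    ≡⟨ +-identityʳ (fromℕ a) ⟨
      fromℕ a + 0ℚ
    ≤⟨ +-monoʳ-≤ (fromℕ a) (fromℕ-nonNeg (b ℕ.∸ a)) ⟩
      fromℕ a + fromℕ (b ℕ.∸ a)
    ≡⟨ fromℕ-+ a (b ℕ.∸ a) ⟨
      fromℕ (a ℕ.+ (b ℕ.∸ a))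
    ≡⟨ cong fromℕ (ℕ.m+[n∸m]≡n a≤b) ⟩
      fromℕ b ∎
    where open ≤-Reasoning

  fromℕ≡mkℚ : ∀ k → fromℕ k ≡ mkℚ (+ k) 0 (Coprime.sym (1-coprimeTo k))
  fromℕ≡mkℚ zero = refl
  fromℕ≡mkℚ (suc k) = toℚᵘ-injective (ℚᵘ.≃-trans (toℚᵘ-homo-+ 1ℚ (fromℕ k))
    (ℚᵘ.≃-trans (ℚᵘ.+-congʳ (toℚᵘ 1ℚ) (ℚᵘ.≃-reflexive (cong toℚᵘ (fromℕ≡mkℚ k)))) (ℚᵘ.*≡* cross-multiplied)))
    where
    cross-multiplied : ((+ 1 ℤ.* + 1) ℤ.+ (+ k ℤ.* + 1)) ℤ.* + 1 ≡ + suc k ℤ.* (+ 1 ℤ.* + 1)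
    cross-multiplied rewrite ℤ.*-identityʳ (+ k) = refl

  1≤positive*denominator : ∀ a d .(cp : Coprime (suc a) (suc d)) → 1ℚ ≤ mkℚ +[1+ a ] d cp * fromℕ (suc d)
  1≤positive*denominator a d cp rewrite fromℕ≡mkℚ (suc d) =
    toℚᵘ-cancel-≤ (ℚᵘ.≤-respʳ-≃ (ℚᵘ.≃-sym (toℚᵘ-homo-* (mkℚ +[1+ a ] d cp) (mkℚ (+ suc d) 0 (Coprime.sym (1-coprimeTo (suc d))))))
                                (ℚᵘ.*≤* (ℤ.+≤+ cross-multiplied)))
    where
    cross-multiplied : 1 ℕ.* (suc d ℕ.* 1) ℕ.≤ suc a ℕ.* suc d ℕ.* 1
    cross-multiplied rewrite ℕ.*-identityˡ (suc d ℕ.* 1) = ℕ.*-monoˡ-≤ 1 (ℕ.m≤n*m (suc d) (suc a))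

  ¼ : ℚ
  ¼ = + 1 / 4

  ratio-bound : ∀ (ε : ℚ) (x n d : ℕ) → n ℕ.≤ x ℕ.+ d → fromℕ d ≤ ε * (¼ * fromℕ n) →
                ((+ 4) / 1 - ε) * (¼ * fromℕ n) ≤ fromℕ x
  ratio-bound ε x n d n≤x+d d≤ε¼n = begin
      ((+ 4) / 1 - ε) * y
    ≡⟨ *-distribʳ-+ y ((+ 4) / 1) (- ε) ⟩
      (+ 4) / 1 * y + (- ε) * y
    ≡⟨ cong₂ _+_ (trans (sym (*-assoc ((+ 4) / 1) ¼ (fromℕ n))) (*-identityˡ (fromℕ n))) (sym (neg-distribˡ-* ε y)) ⟩
      fromℕ n - ε * y
    ≤⟨ +-monoˡ-≤ (- (ε * y)) (subst (fromℕ n ≤_) (fromℕ-+ x d) (fromℕ-mono-≤ n≤x+d)) ⟩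
      (fromℕ x + fromℕ d) - ε * y
    ≤⟨ +-monoˡ-≤ (- (ε * y)) (+-monoʳ-≤ (fromℕ x) d≤ε¼n) ⟩
      (fromℕ x + ε * y) - ε * y
    ≡⟨ +-assoc (fromℕ x) (ε * y) (- (ε * y)) ⟩
      fromℕ x + (ε * y - ε * y)
    ≡⟨ cong (λ q → fromℕ x + q) (+-inverseʳ (ε * y)) ⟩
      fromℕ x + 0ℚ
    ≡⟨ +-identityʳ (fromℕ x) ⟩
      fromℕ x ∎
    where
    open ≤-Reasoning
    y : ℚ
    y = ¼ * fromℕ n

  -- with s = 4 k w:  ε s² / 4 = (ε k) (w s) ≥ w s ≥ 3 s ≥ 2 s + 2
  slack-bound : ∀ (ε : ℚ) (k w s : ℕ) → 1ℚ ≤ ε * fromℕ k → s ≡ 4 ℕ.* k ℕ.* w → 3 ℕ.≤ w → 2 ℕ.≤ s →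
                fromℕ (s ℕ.+ s ℕ.+ 2) ≤ ε * (¼ * fromℕ (s ℕ.* s))
  slack-bound ε k w s 1≤εk s≡4kw 3≤w 2≤s = begin
      fromℕ (s ℕ.+ s ℕ.+ 2)
    ≤⟨ fromℕ-mono-≤ 2s+2≤ws ⟩
      fromℕ (w ℕ.* s)
    ≡⟨ *-identityˡ (fromℕ (w ℕ.* s)) ⟨
      1ℚ * fromℕ (w ℕ.* s)
    ≤⟨ *-monoʳ-≤-nonNeg (fromℕ (w ℕ.* s)) {{nonNegative (fromℕ-nonNeg (w ℕ.* s))}} 1≤εk ⟩
      ε * fromℕ k * fromℕ (w ℕ.* s)
    ≡⟨ *-assoc ε (fromℕ k) (fromℕ (w ℕ.* s)) ⟩
      ε * (fromℕ k * fromℕ (w ℕ.* s))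
    ≡⟨ cong (ε *_) (sym (fromℕ-* k (w ℕ.* s))) ⟩
      ε * fromℕ (k ℕ.* (w ℕ.* s))
    ≡⟨ cong (ε *_) (quarter-of-4* (fromℕ (k ℕ.* (w ℕ.* s)))) ⟨
      ε * (¼ * (fromℕ 4 * fromℕ (k ℕ.* (w ℕ.* s))))
    ≡⟨ cong (λ z → ε * (¼ * z)) (sym (fromℕ-* 4 (k ℕ.* (w ℕ.* s)))) ⟩
      ε * (¼ * fromℕ (4 ℕ.* (k ℕ.* (w ℕ.* s))))
    ≡⟨ cong (λ z → ε * (¼ * fromℕ z)) (sym s²≡4kws) ⟩
      ε * (¼ * fromℕ (s ℕ.* s)) ∎
    where
    open ≤-Reasoning
    quarter-of-4* : ∀ q → ¼ * (fromℕ 4 * q) ≡ q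
    quarter-of-4* q = trans (sym (*-assoc ¼ (fromℕ 4) q)) (*-identityˡ q)
    s²≡4kws : s ℕ.* s ≡ 4 ℕ.* (k ℕ.* (w ℕ.* s))
    s²≡4kws = trans (cong (ℕ._* s) s≡4kw) (reassoc k w s)
      where
      reassoc : ∀ k w s → 4 ℕ.* k ℕ.* w ℕ.* s ≡ 4 ℕ.* (k ℕ.* (w ℕ.* s))
      reassoc = solve-∀
    2s+2≤ws : s ℕ.+ s ℕ.+ 2 ℕ.≤ w ℕ.* s
    2s+2≤ws = ℕ.≤-trans (ℕ.+-monoʳ-≤ (s ℕ.+ s) (ℕ.≤-trans 2≤s (ℕ.≤-reflexive (sym (ℕ.+-identityʳ s)))))
                        (ℕ.≤-trans (ℕ.≤-reflexive (ℕ.+-assoc s s (s ℕ.+ 0))) (ℕ.*-monoˡ-≤ s 3≤w))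

  sumℚ-tabulate : ∀ {k} (h : Fin k → ℚ) (q : ℚ) (G : ℕ → Bool) → (∀ j → h j ≡ q * fromℕ (𝟙 (G (toℕ j)))) →
                  sumℚ (tabulate h) ≡ q * fromℕ (count G k)
  sumℚ-tabulate {zero} h q G eq = sym (*-zeroʳ q)
  sumℚ-tabulate {suc k} h q G eq = begin
      h Fin.zero + sumℚ (tabulate (λ j → h (Fin.suc j)))
    ≡⟨ cong₂ _+_ (eq Fin.zero) (sumℚ-tabulate (λ j → h (Fin.suc j)) q (λ i → G (suc i)) (λ j → eq (Fin.suc j))) ⟩
      q * fromℕ (𝟙 (G 0)) + q * fromℕ (count (λ i → G (suc i)) k)
    ≡⟨ *-distribˡ-+ q (fromℕ (𝟙 (G 0))) _ ⟨
      q * (fromℕ (𝟙 (G 0)) + fromℕ (count (λ i → G (suc i)) k))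
    ≡⟨ cong (q *_) (fromℕ-+ (𝟙 (G 0)) _) ⟨
      q * fromℕ (count G (suc k)) ∎
    where open ≡-Reasoning

module GridTranspose (s : ℕ) .{{_ : NonZero s}} where

  open import Data.Nat
  open import Data.Nat.Properties
  open import Data.Nat.DivMod
  open import Relation.Binary.PropositionalEquality

  grid-< : ∀ {r c} → r < s → c < s → r * s + c < s * s
  grid-< {r} r<s c<s = <-≤-trans (+-monoʳ-< (r * s) c<s) (subst (_≤ s * s) (+-comm s (r * s)) (*-monoˡ-≤ s r<s))

  grid-<-later-row : ∀ {r r′ j} i′ → r < r′ → j < s → r * s + j < r′ * s + i′
  grid-<-later-row {r} {r′} i′ r<r′ j<s =
    <-≤-trans (+-monoʳ-< (r * s) j<s) (≤-trans (≤-reflexive (+-comm (r * s) s)) (≤-trans (*-monoˡ-≤ s r<r′) (m≤m+n (r′ * s) i′)))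

  /s<s : ∀ {k} → k < s * s → k / s < s
  /s<s lt = m<n*o⇒m/o<n lt

  abstract
    transpose : ℕ → ℕ
    transpose k = (k % s) * s + k / s

    transpose-rc : ∀ r {c} → c < s → transpose (r * s + c) ≡ c * s + r
    transpose-rc r {c} c<s = cong₂ (λ a b → a * s + b) %≡ /≡
      where
      swap : r * s + c ≡ c + r * s
      swap = +-comm (r * s) c
      %≡ : (r * s + c) % s ≡ c
      %≡ = trans (cong (_% s) swap) (trans ([m+kn]%n≡m%n c r s) (m<n⇒m%n≡m c<s))
      /≡ : (r * s + c) / s ≡ r
      /≡ = trans (cong (_/ s) swap)
              (trans (+-distrib-/ c (r * s) (subst (_< s) (sym (trans (cong₂ _+_ (m<n⇒m%n≡m c<s) (m*n%n≡0 r s)) (+-identityʳ c))) c<s))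
                     (cong₂ _+_ (m<n⇒m/n≡0 c<s) (m*n/n≡m r s)))

    transpose-< : ∀ {k} → k < s * s → transpose k < s * s
    transpose-< {k} lt = grid-< (m%n<n k s) (/s<s lt)

    transpose-involutive : ∀ {k} → k < s * s → transpose (transpose k) ≡ k
    transpose-involutive {k} lt =
      trans (transpose-rc (k % s) (/s<s lt)) (trans (+-comm (k / s * s) (k % s)) (sym (m≡m%n+[m/n]*n k s)))

module Walks {#V #E : ℕ} (ends : Fin #E → Fin #V × Fin #V) where

  open import Data.Product using (∃; _,_; proj₁)
  open import Data.Sum using (inj₁; inj₂)
  open import Data.Empty using (⊥-elim)
  open import Data.List using (_∷_; [])
  open import Data.List.Relation.Unary.All as All using (All; _∷_; [])
  open import Data.List.Relation.Unary.Any using (here; there)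
  open import Data.List.Relation.Unary.AllPairs using (_∷_)
  open import Data.List.Relation.Unary.Unique.Propositional using (Unique)
  open import Data.List.Membership.Propositional using (_∈_)
  open import Relation.Binary.PropositionalEquality
  open import Relation.Nullary using (¬_; Dec; yes; no)
  open import Defs using (Walk; here; step; Joins)

  Reachable : Fin #V → Fin #V → Set
  Reachable u w = ∃ λ vs → ∃ λ es → Walk ends u w vs es

  Joins-sym : ∀ {e u v} → Joins ends e u v → Joins ends e v u
  Joins-sym (inj₁ x) = inj₂ x
  Joins-sym (inj₂ x) = inj₁ x

  walk-++ : ∀ {u v w vs es} → Walk ends u v vs es → Reachable v w → Reachable u w
  walk-++ (here _) r = r
  walk-++ (step e j rest) r with walk-++ rest r
  ... | _ , _ , wk = _ , _ , step e j wk

  walk-reverse : ∀ {u v vs es} → Walk ends u v vs es → Reachable v u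
  walk-reverse (here u) = _ , _ , here u
  walk-reverse {u} (step e j rest) with walk-reverse rest
  ... | _ , _ , r = walk-++ r (_ , _ , step e (Joins-sym j) (here u))

  walk-head : ∀ {v w vs es} → Walk ends v w vs es → v ∈ vs
  walk-head (here _) = here refl
  walk-head (step _ _ _) = here refl

  module Cut (S : Fin #V → Set) (S? : ∀ v → Dec (S v)) (x y : Fin #V)
             (leaves-only-via : ∀ e u v → Joins ends e u v → S u → ¬ S v → u ≡ x × v ≡ y) where

    enters-via : ∀ {v w vs es} → Walk ends v w vs es → ¬ S v → S w → x ∈ vs
    enters-via (here _) ¬Sv Sw = ⊥-elim (¬Sv Sw)
    enters-via {v} (step {v = v′} e j rest) ¬Sv Sw with S? v′
    ... | yes Sv′ = there (subst (_∈ _) (proj₁ (leaves-only-via e v′ v (Joins-sym j) Sv′ ¬Sv)) (walk-head rest))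
    ... | no ¬Sv′ = there (enters-via rest ¬Sv′ Sw)

    -- a path leaving S would have to return through x, repeating it
    path-stays : ∀ {u w vs es} → Walk ends u w vs es → Unique vs → S u → S w → All S vs
    path-stays (here _) _ Su Sw = Su ∷ []
    path-stays {u} (step {v = v′} {vs = vs′} e j rest) (u∉rest ∷ unique) Su Sw with S? v′
    ... | yes Sv′ = Su ∷ path-stays rest unique Sv′ Sw
    ... | no ¬Sv′ = ⊥-elim (All.lookup u∉rest u∈rest refl)
      where
      u∈rest : u ∈ vs′
      u∈rest = subst (_∈ vs′) (sym (proj₁ (leaves-only-via e u v′ j Su ¬Sv′))) (enters-via rest ¬Sv′ Sw)

-- Vertices 0 … n − 1 are the leaves (in caterpillar order) and n + j, j ≤ c, the spine.
-- Edge i joins i to `upper i`: for a leaf its spine vertex, for a spine vertex the next one.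
module Caterpillar (c′ : ℕ) where

  open import Data.Nat
  open import Data.Nat.Properties
  open import Data.Bool using (false; _∨_)
  open import Data.Bool.Properties using (∨-identityʳ)
  open import Data.Product using (∃; _×_; _,_; proj₁; proj₂)
  open import Data.Sum using (_⊎_; inj₁; inj₂)
  open import Data.Empty using (⊥; ⊥-elim)
  open import Data.Fin using (Fin; toℕ; fromℕ<)
  open import Data.Fin.Properties using (toℕ-fromℕ<; toℕ-injective; toℕ<n; fromℕ<-toℕ)
  open import Data.List using (List; []; _∷_)
  open import Data.List.Relation.Unary.All as All using (All; []; _∷_)
  open import Data.List.Relation.Unary.Any using (Any; here; there)
  open import Data.List.Relation.Unary.AllPairs using ([]; _∷_)
  open import Data.List.Relation.Unary.Unique.Propositional using (Unique)
  open import Data.List.Membership.Propositional using (_∈_)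
  open import Relation.Binary.PropositionalEquality
  open import Relation.Nullary using (¬_; yes; no; does)
  open import Relation.Nullary.Decidable using (does-⇔)
  open import Function.Bundles using (mk⇔)
  import Data.Fin as Fin
  open import Defs
  open Counting

  c : ℕ
  c = suc c′

  n : ℕ
  n = 3 + c

  #V #E : ℕ
  #V = n + suc c
  #E = n + c

  #V≡1+#E : #V ≡ suc #E
  #V≡1+#E = +-suc n c

  spineOf : ℕ → ℕ
  spineOf k = (k ∸ 1) ⊓ c

  spineOf≤c : ∀ k → spineOf k ≤ c
  spineOf≤c k = m⊓n≤n (k ∸ 1) c

  spineOf-mono : ∀ {k l} → k ≤ l → spineOf k ≤ spineOf l
  spineOf-mono k≤l = ⊓-monoˡ-≤ c (∸-monoˡ-≤ 1 k≤l)

  ≤spineOf⇒≤suc : ∀ {j t} → j ≤ suc c → spineOf j ≤ t → j ≤ suc t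
  ≤spineOf⇒≤suc {zero} _ _ = z≤n
  ≤spineOf⇒≤suc {suc j} j≤c spineOf≤t = s≤s (subst (_≤ _) (m≤n⇒m⊓n≡m (s≤s⁻¹ j≤c)) spineOf≤t)

  <spineOf⇒suc< : ∀ {k t} → t < spineOf k → suc t < k
  <spineOf⇒suc< {suc k} t<spineOf = s≤s (≤-trans t<spineOf (m⊓n≤m k c))

  upper : ℕ → ℕ
  upper i with i <? n
  ... | yes _ = n + spineOf i
  ... | no _ = suc i

  upper-leaf : ∀ i → i < n → upper i ≡ n + spineOf i
  upper-leaf i i<n with i <? n
  ... | yes _ = refl
  ... | no i≮n = ⊥-elim (i≮n i<n)

  upper-spine : ∀ i → n ≤ i → upper i ≡ suc i
  upper-spine i n≤i with i <? n
  ... | yes i<n = ⊥-elim (<⇒≱ i<n n≤i)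
  ... | no _ = refl

  n≤upper : ∀ i → n ≤ upper i
  n≤upper i with i <? n
  ... | yes _ = m≤m+n n (spineOf i)
  ... | no i≮n = m≤n⇒m≤1+n (≮⇒≥ i≮n)

  <upper : ∀ i → i < upper i
  <upper i with i <? n
  ... | yes i<n = ≤-trans i<n (m≤m+n n (spineOf i))
  ... | no _ = ≤-refl

  upper<#V : ∀ i → i < #E → upper i < #V
  upper<#V i i<#E with i <? n
  ... | yes _ = +-monoʳ-< n (s≤s (spineOf≤c i))
  ... | no _ = subst (suc i <_) (sym #V≡1+#E) (s≤s i<#E)

  <#V : ∀ {i} → i < #E → i < #V
  <#V {i} i<#E = subst (i <_) (sym #V≡1+#E) (m<n⇒m<1+n i<#E)

  endpoints : Fin #E → Fin #V × Fin #V
  endpoints e = fromℕ< (<#V (toℕ<n e)) , fromℕ< (upper<#V (toℕ e) (toℕ<n e))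

  toℕ-endpoints₁ : ∀ e → toℕ (proj₁ (endpoints e)) ≡ toℕ e
  toℕ-endpoints₁ e = toℕ-fromℕ< (<#V (toℕ<n e))

  toℕ-endpoints₂ : ∀ e → toℕ (proj₂ (endpoints e)) ≡ upper (toℕ e)
  toℕ-endpoints₂ e = toℕ-fromℕ< (upper<#V (toℕ e) (toℕ<n e))

  Joinsℕ : ℕ → ℕ → ℕ → Set
  Joinsℕ i a b = (i ≡ a × upper i ≡ b) ⊎ (i ≡ b × upper i ≡ a)

  Joinsℕ-sym : ∀ {i a b} → Joinsℕ i a b → Joinsℕ i b a
  Joinsℕ-sym (inj₁ x) = inj₂ x
  Joinsℕ-sym (inj₂ x) = inj₁ x

  Joins⇒Joinsℕ : ∀ {e u v} → Joins endpoints e u v → Joinsℕ (toℕ e) (toℕ u) (toℕ v)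
  Joins⇒Joinsℕ {e} (inj₁ refl) = inj₁ (sym (toℕ-endpoints₁ e) , sym (toℕ-endpoints₂ e))
  Joins⇒Joinsℕ {e} (inj₂ refl) = inj₂ (sym (toℕ-endpoints₁ e) , sym (toℕ-endpoints₂ e))

  Joinsℕ⇒Joins : ∀ {e u v} → Joinsℕ (toℕ e) (toℕ u) (toℕ v) → Joins endpoints e u v
  Joinsℕ⇒Joins {e} (inj₁ (a , b)) = inj₁ (cong₂ _,_ (toℕ-injective (trans (toℕ-endpoints₁ e) a))
                                                    (toℕ-injective (trans (toℕ-endpoints₂ e) b)))
  Joinsℕ⇒Joins {e} (inj₂ (a , b)) = inj₂ (cong₂ _,_ (toℕ-injective (trans (toℕ-endpoints₁ e) a))
                                                    (toℕ-injective (trans (toℕ-endpoints₂ e) b)))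

  Joinsℕ-unique : ∀ {i i′ a b} → Joinsℕ i a b → Joinsℕ i′ a b → i ≡ i′
  Joinsℕ-unique (inj₁ (x , _)) (inj₁ (y , _)) = trans x (sym y)
  Joinsℕ-unique (inj₂ (x , _)) (inj₂ (y , _)) = trans x (sym y)
  Joinsℕ-unique {i} {i′} (inj₁ (x , x′)) (inj₂ (y , y′)) =
    ⊥-elim (<-asym (subst₂ _<_ x x′ (<upper i)) (subst₂ _<_ y y′ (<upper i′)))
  Joinsℕ-unique {i} {i′} (inj₂ (x , x′)) (inj₁ (y , y′)) =
    ⊥-elim (<-asym (subst₂ _<_ x x′ (<upper i)) (subst₂ _<_ y y′ (<upper i′)))

  vertex : (a : ℕ) → .(a < #V) → Fin #V
  vertex a h = fromℕ< h

  edge : (i : ℕ) → .(i < #E) → Fin #E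
  edge i h = fromℕ< h

  toℕ-vertex : ∀ a .(h : a < #V) → toℕ (vertex a h) ≡ a
  toℕ-vertex a h = toℕ-fromℕ< h

  toℕ-edge : ∀ i .(h : i < #E) → toℕ (edge i h) ≡ i
  toℕ-edge i h = toℕ-fromℕ< h

  joins : ∀ {i a b} .(hi : i < #E) .(ha : a < #V) .(hb : b < #V) → Joinsℕ i a b →
          Joins endpoints (edge i hi) (vertex a ha) (vertex b hb)
  joins {i} {a} {b} hi ha hb j =
    Joinsℕ⇒Joins (subst₂ (λ x y → Joinsℕ x y (toℕ (vertex b hb))) (sym (toℕ-edge i hi)) (sym (toℕ-vertex a ha))
                         (subst (Joinsℕ i a) (sym (toℕ-vertex b hb)) j))

  open Walks endpoints

  leaf<#V : ∀ {a} → a < n → a < #V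
  leaf<#V a<n = <-≤-trans a<n (m≤m+n n (suc c))

  leaf<#E : ∀ {a} → a < n → a < #E
  leaf<#E a<n = <-≤-trans a<n (m≤m+n n c)

  spine<#V : ∀ {j} → j ≤ c → n + j < #V
  spine<#V j≤c = +-monoʳ-< n (s≤s j≤c)

  ∸n≤c : ∀ {a} → a < #V → a ∸ n ≤ c
  ∸n≤c {a} a<#V = s≤s⁻¹ (m<n+o⇒m∸n<o a n a<#V)

  vertex-cong : ∀ {a b} .{ha : a < #V} .{hb : b < #V} → a ≡ b → vertex a ha ≡ vertex b hb
  vertex-cong refl = refl

  spine : (j : ℕ) → .(j ≤ c) → Fin #V
  spine j h = vertex (n + j) (spine<#V h)

  root : Fin #V
  root = spine 0 z≤n

  spine-edge : ∀ {j} .(h : suc j ≤ c) →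
               Joins endpoints (edge (n + j) (+-monoʳ-< n h)) (spine j (<⇒≤ h)) (spine (suc j) h)
  spine-edge {j} h = joins (+-monoʳ-< n h) (spine<#V (<⇒≤ h)) (spine<#V h)
                           (inj₁ (refl , trans (upper-spine (n + j) (m≤m+n n j)) (sym (+-suc n j))))

  pendant-edge : ∀ {a} (a<n : a < n) →
                 Joins endpoints (edge a (leaf<#E a<n)) (vertex a (leaf<#V a<n)) (spine (spineOf a) (spineOf≤c a))
  pendant-edge {a} a<n = joins (leaf<#E a<n) (leaf<#V a<n) (spine<#V (spineOf≤c a)) (inj₁ (refl , upper-leaf _ a<n))

  spine→root : ∀ j .(h : j ≤ c) → Reachable (spine j h) root
  spine→root zero h = _ , _ , here root
  spine→root (suc j) h with spine→root j (<⇒≤ h)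
  ... | _ , _ , rest = _ , _ , step _ (Joins-sym (spine-edge h)) rest

  vertex→root : ∀ a (h : a < #V) → Reachable (vertex a h) root
  vertex→root a h with a <? n
  ... | yes a<n = walk-++ (step _ (pendant-edge a<n) (here _)) (spine→root (spineOf a) (spineOf≤c a))
  ... | no a≮n = subst (λ v → Reachable v root) (vertex-cong {ha = spine<#V (∸n≤c h)} {hb = h} (m+[n∸m]≡n (≮⇒≥ a≮n)))
                       (spine→root (a ∸ n) (∸n≤c h))

  →root : ∀ u → Reachable u root
  →root u = subst (λ v → Reachable v root) (fromℕ<-toℕ u (toℕ<n u)) (vertex→root (toℕ u) (toℕ<n u))

  caterpillar-connected : ∀ u w → Reachable u w
  caterpillar-connected u w with walk-reverse (proj₂ (proj₂ (→root w)))
  ... | _ , _ , w→root⁻¹ = walk-++ (proj₂ (proj₂ (→root u))) (_ , _ , w→root⁻¹)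

  degreeℕ : ℕ → ℕ
  degreeℕ a = count (λ i → (i ≡ᵇ a) ∨ (upper i ≡ᵇ a)) #E

  deg≡degreeℕ : ∀ v → deg endpoints v ≡ degreeℕ (toℕ v)
  deg≡degreeℕ v = length-filter-tabulate _ (λ e → e) (λ i → (i ≡ᵇ toℕ v) ∨ (upper i ≡ᵇ toℕ v)) λ e →
    cong₂ _∨_ (trans (does-toℕ (proj₁ (endpoints e)) v) (cong (_≡ᵇ toℕ v) (toℕ-endpoints₁ e)))
              (trans (does-toℕ (proj₂ (endpoints e)) v) (cong (_≡ᵇ toℕ v) (toℕ-endpoints₂ e)))
    where
    does-toℕ : ∀ (x y : Fin #V) → does (x Fin.≟ y) ≡ (toℕ x ≡ᵇ toℕ y)
    does-toℕ x y = does-⇔ (mk⇔ (cong toℕ) toℕ-injective) (x Fin.≟ y) (toℕ x ≟ toℕ y)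

  +-≡ᵇ : ∀ k a b → (k + a ≡ᵇ k + b) ≡ (a ≡ᵇ b)
  +-≡ᵇ zero a b = refl
  +-≡ᵇ (suc k) a b = +-≡ᵇ k a b

  degree-leaf : ∀ {a} → a < n → degreeℕ a ≡ 1
  degree-leaf {a} a<n = begin
      degreeℕ a
    ≡⟨ Σ<-split (λ i → 𝟙 ((i ≡ᵇ a) ∨ (upper i ≡ᵇ a))) n c ⟩
      count (λ i → (i ≡ᵇ a) ∨ (upper i ≡ᵇ a)) n + count (λ t → (n + t ≡ᵇ a) ∨ (upper (n + t) ≡ᵇ a)) c
    ≡⟨ cong₂ _+_ (Σ<-cong n (λ i _ → cong 𝟙 (trans (cong ((i ≡ᵇ a) ∨_) (beyond (n≤upper i))) (∨-identityʳ _))))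
                 (Σ<-zero c (λ t _ → cong 𝟙 (cong₂ _∨_ (beyond (m≤m+n n t)) (beyond (n≤upper (n + t)))))) ⟩
      count (_≡ᵇ a) n + 0
    ≡⟨ cong (_+ 0) (count-≡ᵇ-present n a a<n) ⟩
      1 ∎
    where
    open ≡-Reasoning
    beyond : ∀ {z} → n ≤ z → (z ≡ᵇ a) ≡ false
    beyond {z} n≤z = ≢⇒≡ᵇ≡false {z} {a} (λ { refl → <⇒≱ a<n n≤z })

  pendants-at-spine : ∀ {j} → j ≤ c →
    count (λ i → (i ≡ᵇ n + j) ∨ (upper i ≡ᵇ n + j)) n ≡ 𝟙 (0 ≡ᵇ j) + (1 + 𝟙 (c ≡ᵇ j))
  pendants-at-spine {j} j≤c = begin
      count (λ i → (i ≡ᵇ n + j) ∨ (upper i ≡ᵇ n + j)) n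
    ≡⟨ Σ<-cong n (λ i i<n → cong 𝟙 (cong₂ _∨_ (≢⇒≡ᵇ≡false {i} {n + j} (λ { refl → <⇒≱ i<n (m≤m+n n j) }))
                                               (trans (cong (_≡ᵇ n + j) (upper-leaf i i<n)) (+-≡ᵇ n (spineOf i) j)))) ⟩
      count (λ i → spineOf i ≡ᵇ j) n
    ≡⟨ cong (𝟙 (0 ≡ᵇ j) +_) (count-last (λ i → (i ⊓ c) ≡ᵇ j) (suc c)) ⟩
      𝟙 (0 ≡ᵇ j) + (count (λ i → (i ⊓ c) ≡ᵇ j) (suc c) + 𝟙 ((suc c ⊓ c) ≡ᵇ j))
    ≡⟨ cong (𝟙 (0 ≡ᵇ j) +_) (cong₂ _+_ (trans (Σ<-cong (suc c) (λ i i≤c → cong (λ z → 𝟙 (z ≡ᵇ j)) (m≤n⇒m⊓n≡m (s≤s⁻¹ i≤c))))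
                                              (count-≡ᵇ-present (suc c) j (s≤s j≤c)))
                                       (cong (λ z → 𝟙 (z ≡ᵇ j)) (m≥n⇒m⊓n≡n (n≤1+n c)))) ⟩
      𝟙 (0 ≡ᵇ j) + (1 + 𝟙 (c ≡ᵇ j)) ∎
    where open ≡-Reasoning

  spine-edges-at-spine : ∀ j →
    count (λ t → (n + t ≡ᵇ n + j) ∨ (upper (n + t) ≡ᵇ n + j)) c ≡ count (_≡ᵇ j) c + count (λ t → suc t ≡ᵇ j) c
  spine-edges-at-spine j = trans
    (Σ<-cong c (λ t _ → trans (cong 𝟙 (cong₂ _∨_ (+-≡ᵇ n t j)
                                                 (trans (cong (_≡ᵇ n + j) (trans (upper-spine (n + t) (m≤m+n n t)) (sym (+-suc n t))))
                                                        (+-≡ᵇ n (suc t) j))))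
                              (𝟙-∨-suc t j)))
    (Σ<-+ (λ t → 𝟙 (t ≡ᵇ j)) (λ t → 𝟙 (suc t ≡ᵇ j)) c)
    where
    𝟙-∨-suc : ∀ t j → 𝟙 ((t ≡ᵇ j) ∨ (suc t ≡ᵇ j)) ≡ 𝟙 (t ≡ᵇ j) + 𝟙 (suc t ≡ᵇ j)
    𝟙-∨-suc zero zero = refl
    𝟙-∨-suc zero (suc zero) = refl
    𝟙-∨-suc zero (suc (suc j)) = refl
    𝟙-∨-suc (suc t) zero = refl
    𝟙-∨-suc (suc t) (suc j) = 𝟙-∨-suc t j

  -- spine vertex j carries the pendant edge of leaf j + 1, also those of leaf 0 if j = 0 and of leaf c + 2
  -- if j = c, and the spine edges to j − 1 and j + 1 where these exist
  degree-spine : ∀ {j} → j ≤ c → degreeℕ (n + j) ≡ 3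
  degree-spine {j} j≤c =
    trans (Σ<-split (λ i → 𝟙 ((i ≡ᵇ n + j) ∨ (upper i ≡ᵇ n + j))) n c)
          (trans (cong₂ _+_ (pendants-at-spine j≤c) (spine-edges-at-spine j)) (by-position j j≤c))
    where
    by-position : ∀ j → j ≤ c →
                  𝟙 (0 ≡ᵇ j) + (1 + 𝟙 (c ≡ᵇ j)) + (count (_≡ᵇ j) c + count (λ t → suc t ≡ᵇ j) c) ≡ 3
    by-position zero _ rewrite Σ<-zero {λ t → 𝟙 (suc t ≡ᵇ 0)} c (λ _ _ → refl) = refl
    by-position (suc j) 1+j≤c with m≤n⇒m<n∨m≡n 1+j≤c
    ... | inj₁ 1+j<c rewrite ≢⇒≡ᵇ≡false {c} {suc j} (>⇒≢ 1+j<c) | count-≡ᵇ-present c (suc j) 1+j<c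
                           | count-≡ᵇ-present c j (<-trans (n<1+n j) 1+j<c) = refl
    ... | inj₂ refl rewrite ≡ᵇ-refl c | count-≡ᵇ-absent c c ≤-refl | count-≡ᵇ-present c c′ ≤-refl = refl

  -- leaf i of the tree sits at caterpillar position σ i
  module Labelled (σ : ℕ → ℕ) (σ-< : ∀ {i} → i < n → σ i < n) (σ-involutive : ∀ {i} → i < n → σ (σ i) ≡ i) where

    leafAt : Fin n → Fin #V
    leafAt i = vertex (σ (toℕ i)) (leaf<#V (σ-< (toℕ<n i)))

    toℕ-leafAt : ∀ i → toℕ (leafAt i) ≡ σ (toℕ i)
    toℕ-leafAt i = toℕ-vertex _ (leaf<#V (σ-< (toℕ<n i)))

    leafAt-injective : ∀ i j → leafAt i ≡ leafAt j → i ≡ j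
    leafAt-injective i j eq = toℕ-injective (begin
        toℕ i             ≡⟨ σ-involutive (toℕ<n i) ⟨
        σ (σ (toℕ i))     ≡⟨ cong σ (trans (sym (toℕ-leafAt i)) (trans (cong toℕ eq) (toℕ-leafAt j))) ⟩
        σ (σ (toℕ j))     ≡⟨ σ-involutive (toℕ<n j) ⟩
        toℕ j             ∎)
      where open ≡-Reasoning

    leaf-or-spine : ∀ v → (deg endpoints v ≡ 1 × ∃ λ i → leafAt i ≡ v) ⊎ (deg endpoints v ≡ 3 × ¬ (∃ λ i → leafAt i ≡ v))
    leaf-or-spine v with toℕ v <? n
    ... | yes v<n = inj₁ (trans (deg≡degreeℕ v) (degree-leaf v<n) ,
                          fromℕ< (σ-< v<n) ,
                          toℕ-injective (trans (toℕ-leafAt _) (trans (cong σ (toℕ-fromℕ< (σ-< v<n))) (σ-involutive v<n))))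
    ... | no v≮n = inj₂ (trans (deg≡degreeℕ v) (trans (cong degreeℕ (sym (m+[n∸m]≡n (≮⇒≥ v≮n))))
                                                      (degree-spine (∸n≤c (toℕ<n v)))) ,
                         λ { (i , refl) → v≮n (subst (_< n) (sym (toℕ-leafAt i)) (σ-< (toℕ<n i))) })

    tree : BinPhyloTree n
    tree = record
      { V = #V
      ; m = #E
      ; ends = endpoints
      ; loopless = λ e eq → <-irrefl (trans (sym (toℕ-endpoints₁ e)) (trans (cong toℕ eq) (toℕ-endpoints₂ e))) (<upper (toℕ e))
      ; simple = λ e f u v j₁ j₂ → toℕ-injective (Joinsℕ-unique (Joins⇒Joinsℕ j₁) (Joins⇒Joinsℕ j₂))
      ; connected = caterpillar-connected
      ; edgeCount = sym #V≡1+#E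
      ; leaf = leafAt
      ; leafInj = leafAt-injective
      ; degrees = leaf-or-spine
      }

  record PathFromSpine (i q : ℕ) .(i≤c : i ≤ c) .(q<n : q < n) : Set where
    field
      vs : List (Fin #V)
      es : List (Fin #E)
      walk : Walk endpoints (spine i i≤c) (vertex q (leaf<#V q<n)) vs es
      unique : Unique vs
      above : All (λ v → toℕ v ≡ q ⊎ n + i ≤ toℕ v) vs
      visits : ∀ t → i ≤ t → t ≤ spineOf q → Any (λ v → toℕ v ≡ n + t) vs
      uses : All (λ e → toℕ e ≡ q ⊎ (n + i ≤ toℕ e × toℕ e < n + spineOf q)) es

  ≤spineOf⇒≤c : ∀ q {i} l → i + l ≡ spineOf q → i ≤ c
  ≤spineOf⇒≤c q {i} l eq = ≤-trans (m≤m+n i l) (subst (_≤ c) (sym eq) (spineOf≤c q))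

  pathFromSpine : ∀ {q} (q<n : q < n) i l (eq : i + l ≡ spineOf q) → PathFromSpine i q (≤spineOf⇒≤c q l eq) q<n
  pathFromSpine {q} q<n i zero eq = record
    { vs = spine i i≤c ∷ vertex q (leaf<#V q<n) ∷ []
    ; es = edge q (leaf<#E q<n) ∷ []
    ; walk = step _ (joins (leaf<#E q<n) (spine<#V i≤c) (leaf<#V q<n)
                           (inj₂ (refl , trans (upper-leaf q q<n) (cong (n +_) (sym i≡)))))
                    (here _)
    ; unique = (spine≢leaf ∷ []) ∷ [] ∷ []
    ; above = inj₂ (≤-reflexive (sym (toℕ-vertex (n + i) (spine<#V i≤c)))) ∷ inj₁ (toℕ-vertex q (leaf<#V q<n)) ∷ []
    ; visits = λ t i≤t t≤ → here (trans (toℕ-vertex (n + i) (spine<#V i≤c))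
                                        (cong (n +_) (≤-antisym i≤t (subst (t ≤_) (sym i≡) t≤))))
    ; uses = inj₁ (toℕ-edge q (leaf<#E q<n)) ∷ []
    }
    where
    i≡ : i ≡ spineOf q
    i≡ = trans (sym (+-identityʳ i)) eq
    i≤c : i ≤ c
    i≤c = subst (_≤ c) (sym i≡) (spineOf≤c q)
    spine≢leaf : spine i i≤c ≢ vertex q (leaf<#V q<n)
    spine≢leaf e = <⇒≢ (<-≤-trans q<n (m≤m+n n i))
      (sym (trans (sym (toℕ-vertex (n + i) (spine<#V i≤c))) (trans (cong toℕ e) (toℕ-vertex q (leaf<#V q<n)))))
  pathFromSpine {q} q<n i (suc l) eq = record
    { vs = spine i i≤c ∷ PathFromSpine.vs rest
    ; es = edge (n + i) n+i<#E ∷ PathFromSpine.es rest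
    ; walk = step _ (spine-edge (<-≤-trans i<spineOf (spineOf≤c q))) (PathFromSpine.walk rest)
    ; unique = All.map spine≢ (PathFromSpine.above rest) ∷ PathFromSpine.unique rest
    ; above = inj₂ (≤-reflexive (sym (toℕ-vertex (n + i) (spine<#V i≤c)))) ∷ All.map weaken (PathFromSpine.above rest)
    ; visits = visits
    ; uses = inj₂ (≤-reflexive (sym (toℕ-edge (n + i) n+i<#E)) ,
                   subst (_< n + spineOf q) (sym (toℕ-edge (n + i) n+i<#E)) (+-monoʳ-< n i<spineOf))
             ∷ All.map weakenₑ (PathFromSpine.uses rest)
    }
    where
    i<spineOf : i < spineOf q
    i<spineOf = subst (i <_) eq (m<m+n i z<s)
    i≤c : i ≤ c
    i≤c = ≤-trans (<⇒≤ i<spineOf) (spineOf≤c q)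
    n+i<#E : n + i < #E
    n+i<#E = +-monoʳ-< n (<-≤-trans i<spineOf (spineOf≤c q))
    rest : PathFromSpine (suc i) q _ q<n
    rest = pathFromSpine q<n (suc i) l (trans (sym (+-suc i l)) eq)
    spine≢ : ∀ {v} → (toℕ v ≡ q ⊎ n + suc i ≤ toℕ v) → spine i i≤c ≢ v
    spine≢ (inj₁ e) e′ =
      <⇒≢ (<-≤-trans q<n (m≤m+n n i)) (sym (trans (sym (toℕ-vertex (n + i) (spine<#V i≤c))) (trans (cong toℕ e′) e)))
    spine≢ {v} (inj₂ le) e′ =
      <⇒≢ (subst (_≤ toℕ v) (+-suc n i) le) (trans (sym (toℕ-vertex (n + i) (spine<#V i≤c))) (cong toℕ e′))
    weaken : ∀ {v} → (toℕ v ≡ q ⊎ n + suc i ≤ toℕ v) → (toℕ v ≡ q ⊎ n + i ≤ toℕ v)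
    weaken (inj₁ e) = inj₁ e
    weaken (inj₂ le) = inj₂ (≤-trans (+-monoʳ-≤ n (n≤1+n i)) le)
    weakenₑ : ∀ {e} → (toℕ e ≡ q ⊎ (n + suc i ≤ toℕ e × toℕ e < n + spineOf q)) →
                      (toℕ e ≡ q ⊎ (n + i ≤ toℕ e × toℕ e < n + spineOf q))
    weakenₑ (inj₁ e) = inj₁ e
    weakenₑ (inj₂ (le , lt)) = inj₂ (≤-trans (+-monoʳ-≤ n (n≤1+n i)) le , lt)
    visits : ∀ t → i ≤ t → t ≤ spineOf q → Any (λ v → toℕ v ≡ n + t) (spine i i≤c ∷ PathFromSpine.vs rest)
    visits t i≤t t≤ with m≤n⇒m<n∨m≡n i≤t
    ... | inj₁ i<t = there (PathFromSpine.visits rest t i<t t≤)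
    ... | inj₂ refl = here (toℕ-vertex (n + i) (spine<#V i≤c))

  record PathBetweenLeaves (p q : ℕ) .(p<n : p < n) .(q<n : q < n) : Set where
    field
      vs : List (Fin #V)
      es : List (Fin #E)
      walk : Walk endpoints (vertex p (leaf<#V p<n)) (vertex q (leaf<#V q<n)) vs es
      unique : Unique vs
      visits : ∀ t → spineOf p ≤ t → t ≤ spineOf q → Any (λ v → toℕ v ≡ n + t) vs
      uses : All (λ e → toℕ e ≡ p ⊎ toℕ e ≡ q ⊎ (n + spineOf p ≤ toℕ e × toℕ e < n + spineOf q)) es

  pathBetweenLeaves : ∀ {p q} (p<q : p < q) (q<n : q < n) → PathBetweenLeaves p q (<-trans p<q q<n) q<n
  pathBetweenLeaves {p} {q} p<q q<n = record
    { vs = vertex p (leaf<#V p<n) ∷ PathFromSpine.vs rest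
    ; es = edge p (leaf<#E p<n) ∷ PathFromSpine.es rest
    ; walk = step _ (pendant-edge p<n) (PathFromSpine.walk rest)
    ; unique = All.map leaf≢ (PathFromSpine.above rest) ∷ PathFromSpine.unique rest
    ; visits = λ t lo hi → there (PathFromSpine.visits rest t lo hi)
    ; uses = inj₁ (toℕ-edge p (leaf<#E p<n)) ∷ All.map inj₂ (PathFromSpine.uses rest)
    }
    where
    p<n : p < n
    p<n = <-trans p<q q<n
    rest : PathFromSpine (spineOf p) q _ q<n
    rest = pathFromSpine q<n (spineOf p) (spineOf q ∸ spineOf p) (m+[n∸m]≡n (spineOf-mono (<⇒≤ p<q)))
    leaf≢ : ∀ {v} → (toℕ v ≡ q ⊎ n + spineOf p ≤ toℕ v) → vertex p (leaf<#V p<n) ≢ v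
    leaf≢ (inj₁ e) e′ = <⇒≢ p<q (trans (sym (toℕ-vertex p (leaf<#V p<n))) (trans (cong toℕ e′) e))
    leaf≢ {v} (inj₂ le) e′ =
      <⇒≢ (<-≤-trans p<n (≤-trans (m≤m+n n (spineOf p)) le)) (trans (sym (toℕ-vertex p (leaf<#V p<n))) (cong toℕ e′))

  rank : ℕ → ℕ
  rank a with a <? n
  ... | yes _ = a
  ... | no _ = suc (a ∸ n)

  rank-leaf : ∀ {a} → a < n → rank a ≡ a
  rank-leaf {a} a<n with a <? n
  ... | yes _ = refl
  ... | no a≮n = ⊥-elim (a≮n a<n)

  rank-spine : ∀ j → rank (n + j) ≡ suc j
  rank-spine j with n + j <? n
  ... | yes n+j<n = ⊥-elim (<⇒≱ n+j<n (m≤m+n n j))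
  ... | no _ = cong suc (m+n∸m≡n n j)

  pendant-stays : ∀ {t i a b} → i < n → suc t ≤ c → Joinsℕ i a b → rank a ≤ suc t → suc t < rank b → ⊥
  pendant-stays {t} {i} i<n t<c (inj₁ (refl , refl)) ra rb
    rewrite rank-leaf i<n | upper-leaf i i<n | rank-spine (spineOf i) =
    <-irrefl refl (≤-trans (s≤s⁻¹ rb) (≤-trans (m⊓n≤m (i ∸ 1) c) (∸-monoˡ-≤ 1 ra)))
  pendant-stays {t} {i} i<n t<c (inj₂ (refl , refl)) ra rb
    rewrite rank-leaf i<n | upper-leaf i i<n | rank-spine (spineOf i) =
    <-irrefl refl (≤-trans (⊓-glb (∸-monoˡ-≤ 1 rb) t<c) (s≤s⁻¹ ra))

  spine-crossing : ∀ {t j a b} → Joinsℕ (n + j) a b → rank a ≤ suc t → suc t < rank b → a ≡ n + t × b ≡ n + suc t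
  spine-crossing {t} {j} (inj₁ (refl , up≡b)) ra rb = cong (n +_) j≡t , trans (sym up≡b) (trans upper≡ (cong (λ k → n + suc k) j≡t))
    where
    upper≡ : upper (n + j) ≡ n + suc j
    upper≡ = trans (upper-spine (n + j) (m≤m+n n j)) (sym (+-suc n j))
    j≡t : j ≡ t
    j≡t = ≤-antisym (s≤s⁻¹ (subst (_≤ suc t) (rank-spine j) ra))
                    (s≤s⁻¹ (s≤s⁻¹ (subst (suc t <_) (trans (cong rank (trans (sym up≡b) upper≡)) (rank-spine (suc j))) rb)))
  spine-crossing {t} {j} (inj₂ (refl , up≡a)) ra rb =
    ⊥-elim (<-irrefl refl (<-≤-trans (<-trans (subst (suc t <_) (rank-spine j) rb) (n<1+n (suc j)))
                                     (subst (_≤ suc t) (trans (cong rank (trans (sym up≡a) upper≡)) (rank-spine (suc j))) ra)))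
    where
    upper≡ : upper (n + j) ≡ n + suc j
    upper≡ = trans (upper-spine (n + j) (m≤m+n n j)) (sym (+-suc n j))

  -- the vertices of rank ≤ t + 1, i.e. leaves ≤ t + 1 and spine vertices ≤ t, are cut off by the spine edge t — t + 1
  crossing : ∀ {t i a b} → suc t ≤ c → Joinsℕ i a b → rank a ≤ suc t → suc t < rank b → a ≡ n + t × b ≡ n + suc t
  crossing {i = i} t<c j ra rb with n ≤? i
  ... | no n≰i = ⊥-elim (pendant-stays (≰⇒> n≰i) t<c j ra rb)
  ... | yes n≤i = spine-crossing (subst (λ k → Joinsℕ k _ _) (sym (m+[n∸m]≡n n≤i)) j) ra rb

  paths-separated : ∀ {k} → 0 < k → k ≤ c → ∀ {u₁ u₂ u₃ u₄ vs es vs′ es′} →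
    Walk endpoints u₁ u₂ vs es → Unique vs → Walk endpoints u₃ u₄ vs′ es′ → Unique vs′ →
    rank (toℕ u₁) ≤ k → rank (toℕ u₂) ≤ k → k < rank (toℕ u₃) → k < rank (toℕ u₄) →
    ∀ v → v ∈ vs → ¬ v ∈ vs′
  paths-separated {suc t} _ t<c w₁ unique₁ w₂ unique₂ r₁ r₂ r₃ r₄ v v∈vs v∈vs′ =
    <⇒≱ (All.lookup (High.path-stays w₂ unique₂ r₃ r₄) v∈vs′) (All.lookup (Low.path-stays w₁ unique₁ r₁ r₂) v∈vs)
    where
    x y : Fin #V
    x = spine t (<⇒≤ t<c)
    y = spine (suc t) t<c
    toℕ-x : toℕ x ≡ n + t
    toℕ-x = toℕ-vertex (n + t) (spine<#V (<⇒≤ t<c))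
    toℕ-y : toℕ y ≡ n + suc t
    toℕ-y = toℕ-vertex (n + suc t) (spine<#V t<c)
    low-exit : ∀ e u v → Joins endpoints e u v → rank (toℕ u) ≤ suc t → ¬ rank (toℕ v) ≤ suc t → u ≡ x × v ≡ y
    low-exit e u v j ru ¬rv with crossing t<c (Joins⇒Joinsℕ j) ru (≰⇒> ¬rv)
    ... | u≡ , v≡ = toℕ-injective (trans u≡ (sym toℕ-x)) , toℕ-injective (trans v≡ (sym toℕ-y))
    high-exit : ∀ e u v → Joins endpoints e u v → suc t < rank (toℕ u) → ¬ suc t < rank (toℕ v) → u ≡ y × v ≡ x
    high-exit e u v j ru ¬rv with crossing t<c (Joinsℕ-sym (Joins⇒Joinsℕ j)) (≮⇒≥ ¬rv) ru
    ... | v≡ , u≡ = toℕ-injective (trans u≡ (sym toℕ-y)) , toℕ-injective (trans v≡ (sym toℕ-x))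
    module Low = Cut (λ v → rank (toℕ v) ≤ suc t) (λ v → rank (toℕ v) ≤? suc t) x y low-exit
    module High = Cut (λ v → suc t < rank (toℕ v)) (λ v → suc t <? rank (toℕ v)) y x high-exit

module PendantWeights (c′ : ℕ) where

  open import Data.Nat as ℕ using (_<_; _<?_; z≤n)
  open import Data.Nat.Properties using (<⇒≱)
  open import Data.Product using (_,_)
  open import Data.Sum using (inj₁; inj₂)
  open import Data.Empty using (⊥-elim)
  open import Data.Fin using (Fin; toℕ)
  open import Data.List using ([]; _∷_; map)
  open import Relation.Binary.PropositionalEquality
  open import Relation.Nullary using (yes; no)
  open import Data.Rational using (ℚ; 0ℚ; ½; _+_; _≤_)
  open import Data.Rational.Properties using (+-mono-≤; ≤-refl; ≤-reflexive; +-identityʳ; +-identityˡ)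
  open import Data.Integer using (+≤+)
  import Data.Rational as ℚ
  open import Defs
  open Caterpillar c′
  open RationalBounds using (¼)

  y : Fin #E → ℚ
  y e with toℕ e <? n
  ... | yes _ = ¼
  ... | no _ = 0ℚ

  y-nonNeg : ∀ e → 0ℚ ≤ y e
  y-nonNeg e with toℕ e <? n
  ... | yes _ = ℚ.*≤* (+≤+ z≤n)
  ... | no _ = ≤-refl

  y-pendant : ∀ e → toℕ e < n → y e ≡ ¼
  y-pendant e e<n with toℕ e <? n
  ... | yes _ = refl
  ... | no e≮n = ⊥-elim (e≮n e<n)

  y-spine : ∀ e → n ℕ.≤ toℕ e → y e ≡ 0ℚ
  y-spine e n≤e with toℕ e <? n
  ... | yes e<n = ⊥-elim (<⇒≱ e<n n≤e)
  ... | no _ = refl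

  sum-nonNeg : ∀ es → 0ℚ ≤ sumℚ (map y es)
  sum-nonNeg [] = ≤-refl
  sum-nonNeg (e ∷ es) = +-mono-≤ (y-nonNeg e) (sum-nonNeg es)

  y-into-leaf : ∀ {e a b} → Joinsℕ (toℕ e) a b → b < n → y e ≡ ¼
  y-into-leaf {e} (inj₁ (_ , up≡b)) b<n = ⊥-elim (<⇒≱ b<n (subst (n ℕ.≤_) up≡b (n≤upper (toℕ e))))
  y-into-leaf {e} (inj₂ (e≡b , _)) b<n = y-pendant e (subst (_< n) (sym e≡b) b<n)

  walk-into-leaf-≥¼ : ∀ {v w vs es} → Walk endpoints v w vs es → v ≢ w → toℕ w < n → ¼ ≤ sumℚ (map y es)
  walk-into-leaf-≥¼ (here _) v≢w _ = ⊥-elim (v≢w refl)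
  walk-into-leaf-≥¼ {v} {w} (step {v = v′} {es = es′} e j rest) v≢w w<n with toℕ v′ ℕ.≟ toℕ w
  ... | yes v′≡w = subst (_≤ y e + sumℚ (map y es′)) (+-identityʳ ¼)
                     (+-mono-≤ (≤-reflexive (sym (y-into-leaf (Joins⇒Joinsℕ j) (subst (_< n) (sym v′≡w) w<n)))) (sum-nonNeg es′))
  ... | no v′≢w = subst (_≤ y e + sumℚ (map y es′)) (+-identityˡ ¼)
                     (+-mono-≤ (y-nonNeg e) (walk-into-leaf-≥¼ rest (λ eq → v′≢w (cong toℕ eq)) w<n))

  -- a walk between distinct leaves starts and ends with a pendant edge
  leaf-walk-≥½ : ∀ {u w vs es} → Walk endpoints u w vs es → u ≢ w → toℕ u < n → toℕ w < n → ½ ≤ sumℚ (map y es)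
  leaf-walk-≥½ (here _) u≢w _ _ = ⊥-elim (u≢w refl)
  leaf-walk-≥½ {u} {w} (step {v = v′} e j rest) u≢w u<n w<n with Joins⇒Joinsℕ j
  ... | inj₂ (_ , up≡u) = ⊥-elim (<⇒≱ u<n (subst (n ℕ.≤_) up≡u (n≤upper (toℕ e))))
  ... | inj₁ (e≡u , up≡v′) =
    +-mono-≤ (≤-reflexive (sym (y-pendant e (subst (_< n) (sym e≡u) u<n))))
             (walk-into-leaf-≥¼ rest v′≢w w<n)
    where
    v′≢w : v′ ≢ w
    v′≢w v′≡w = <⇒≱ w<n (subst (n ℕ.≤_) (trans up≡v′ (cong toℕ v′≡w)) (n≤upper (toℕ e)))

module Construction (s : ℕ) (2≤s : 2 ℕ.≤ s) where

  open import Data.Nat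
  open import Data.Nat.Properties
  open import Data.Bool using (Bool; false)
  open import Data.Product using (∃; _×_; _,_; proj₁; proj₂)
  open import Data.Sum using (_⊎_; inj₁; inj₂)
  open import Data.Empty using (⊥; ⊥-elim)
  open import Data.Fin using (Fin; toℕ; fromℕ<)
  open import Data.Fin.Properties using (toℕ-fromℕ<; toℕ-injective; toℕ<n; fromℕ<-toℕ)
  open import Data.List using (List; []; _∷_; map; tabulate)
  open import Data.List.Properties using (map-tabulate)
  open import Data.List.Relation.Unary.All as All using (All; []; _∷_)
  open import Data.List.Membership.Propositional using (_∈_; find)
  open import Relation.Binary.PropositionalEquality
  open import Relation.Nullary using (¬_; yes; no; does)
  open import Relation.Nullary.Decidable using (dec-true; dec-false)
  open import Function using (id)
  open import Defs
  open import Data.Rational as ℚ using (ℚ; 0ℚ; 1ℚ)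
  import Data.Rational.Properties as ℚ
  import Data.Integer as ℤ
  open Counting
  open RationalBounds using (fromℕ; ¼; sumℚ-tabulate; ratio-bound)

  instance
    s-nonZero : NonZero s
    s-nonZero = >-nonZero (<-≤-trans z<s 2≤s)

  open GridTranspose s

  c′ : ℕ
  c′ = s * s ∸ 4

  open Caterpillar c′

  n≡s² : n ≡ s * s
  n≡s² = m+[n∸m]≡n (*-mono-≤ 2≤s 2≤s)

  <n⇒<s² : ∀ {k} → k < n → k < s * s
  <n⇒<s² {k} = subst (k <_) n≡s²

  <s²⇒<n : ∀ {k} → k < s * s → k < n
  <s²⇒<n {k} = subst (k <_) (sym n≡s²)

  module Ordered = Labelled id id (λ _ → refl)
  module Transposed = Labelled transpose (λ h → <s²⇒<n (transpose-< (<n⇒<s² h))) (λ h → transpose-involutive (<n⇒<s² h))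

  T₁ T₂ : BinPhyloTree n
  T₁ = Ordered.tree
  T₂ = Transposed.tree

  label : (k : ℕ) → k < n → Fin n
  label k h = fromℕ< h

  Ordered-leaf : ∀ {k} (h : k < n) → Ordered.leafAt (label k h) ≡ vertex k (leaf<#V h)
  Ordered-leaf {k} h = toℕ-injective (trans (Ordered.toℕ-leafAt (label k h))
                                            (trans (toℕ-fromℕ< h) (sym (toℕ-vertex k (leaf<#V h)))))

  Transposed-leaf : ∀ {k} (h : k < n) (h′ : transpose k < n) → Transposed.leafAt (label k h) ≡ vertex (transpose k) (leaf<#V h′)
  Transposed-leaf {k} h h′ = toℕ-injective (trans (Transposed.toℕ-leafAt (label k h))
                                                   (trans (cong transpose (toℕ-fromℕ< h)) (sym (toℕ-vertex (transpose k) (leaf<#V h′)))))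

  walk-cast : ∀ {u u′ w w′ vs es} → u ≡ u′ → w ≡ w′ → Walk endpoints u w vs es → Walk endpoints u′ w′ vs es
  walk-cast refl refl walk = walk

  module Quartet {r r′ i i′ j} (r<r′ : r < r′) (r′<s : r′ < s) (i<j : i < j) (i′<j : i′ < j) (j<s : j < s) where

    A B A′ B′ : ℕ
    A = r * s + i
    B = r * s + j
    A′ = r′ * s + i′
    B′ = r′ * s + j

    A<B : A < B
    A<B = +-monoʳ-< (r * s) i<j

    B<A′ : B < A′
    B<A′ = grid-<-later-row i′ r<r′ j<s

    A′<B′ : A′ < B′
    A′<B′ = +-monoʳ-< (r′ * s) i′<j

    B′<n : B′ < n
    B′<n = <s²⇒<n (grid-< r′<s j<s)

    A′<n : A′ < n
    A′<n = <-trans A′<B′ B′<n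

    B<n : B < n
    B<n = <-trans B<A′ A′<n

    A<n : A < n
    A<n = <-trans A<B B<n

    a b a′ b′ : Fin n
    a = label A A<n
    b = label B B<n
    a′ = label A′ A′<n
    b′ = label B′ B′<n

    distinct : Distinct4 a b a′ b′
    distinct = label≢ A<n B<n A<B , label≢ A<n A′<n (<-trans A<B B<A′) , label≢ A<n B′<n (<-trans A<B (<-trans B<A′ A′<B′)) ,
               label≢ B<n A′<n B<A′ , label≢ B<n B′<n (<-trans B<A′ A′<B′) , label≢ A′<n B′<n A′<B′
      where
      label≢ : ∀ {x y} (hx : x < n) (hy : y < n) → x < y → label x hx ≢ label y hy
      label≢ {x} {y} hx hy x<y eq = <⇒≢ x<y (trans (sym (toℕ-fromℕ< hx)) (trans (cong toℕ eq) (toℕ-fromℕ< hy)))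

    path₁ : PathBetweenLeaves A B _ B<n
    path₁ = pathBetweenLeaves A<B B<n

    path₂ : PathBetweenLeaves A′ B′ _ B′<n
    path₂ = pathBetweenLeaves A′<B′ B′<n

    ordered-path₁ : LeafPath T₁ a b (PathBetweenLeaves.vs path₁) (PathBetweenLeaves.es path₁)
    ordered-path₁ = walk-cast (sym (Ordered-leaf A<n)) (sym (Ordered-leaf B<n)) (PathBetweenLeaves.walk path₁) ,
                    PathBetweenLeaves.unique path₁

    ordered-path₂ : LeafPath T₁ a′ b′ (PathBetweenLeaves.vs path₂) (PathBetweenLeaves.es path₂)
    ordered-path₂ = walk-cast (sym (Ordered-leaf A′<n)) (sym (Ordered-leaf B′<n)) (PathBetweenLeaves.walk path₂) ,
                    PathBetweenLeaves.unique path₂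

    -- the spine edge B − 1 — B of T₁ separates {A, B} from {A′, B′}
    displayed₁ : Displays T₁ a b a′ b′
    displayed₁ vs es vs′ es′ (w₁ , unique₁) (w₂ , unique₂) =
      paths-separated 0<B B≤c w₁ unique₁ w₂ unique₂
        (subst (_≤ B) (sym (rank-of A<n)) (<⇒≤ A<B)) (≤-reflexive (rank-of B<n))
        (subst (B <_) (sym (rank-of A′<n)) B<A′) (subst (B <_) (sym (rank-of B′<n)) (<-trans B<A′ A′<B′))
      where
      0<B : 0 < B
      0<B = <-≤-trans (≤-<-trans z≤n i<j) (m≤n+m j (r * s))
      B≤c : B ≤ c
      B≤c = s≤s⁻¹ (s≤s⁻¹ (s≤s⁻¹ (≤-trans (s≤s (s≤s B<A′)) (≤-trans (s≤s A′<B′) B′<n))))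
      rank-of : ∀ {k} (h : k < n) → rank (toℕ (Ordered.leafAt (label k h))) ≡ k
      rank-of {k} h = trans (cong rank (trans (Ordered.toℕ-leafAt (label k h)) (toℕ-fromℕ< h))) (rank-leaf h)

    -- transposed, the positions interleave: i s + r < j s + r ≤ j s + r′ and i′ s + r′ < j s + r′
    τA<τB : transpose A < transpose B
    τA<τB = subst₂ _<_ (sym (transpose-rc r (<-trans i<j j<s))) (sym (transpose-rc r j<s)) (+-monoˡ-< r (*-monoˡ-< s i<j))

    τA′<τB′ : transpose A′ < transpose B′
    τA′<τB′ = subst₂ _<_ (sym (transpose-rc r′ (<-trans i′<j j<s))) (sym (transpose-rc r′ j<s))
                         (+-monoˡ-< r′ (*-monoˡ-< s i′<j))

    τA′≤τB : transpose A′ ≤ transpose B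
    τA′≤τB = subst₂ _≤_ (sym (transpose-rc r′ (<-trans i′<j j<s))) (sym (transpose-rc r j<s))
               (<⇒≤ (grid-<-later-row r i′<j r′<s))

    τB≤τB′ : transpose B ≤ transpose B′
    τB≤τB′ = subst₂ _≤_ (sym (transpose-rc r j<s)) (sym (transpose-rc r′ j<s)) (+-monoʳ-≤ (j * s) (<⇒≤ r<r′))

    τB<n : transpose B < n
    τB<n = <s²⇒<n (transpose-< (<n⇒<s² B<n))

    τB′<n : transpose B′ < n
    τB′<n = <s²⇒<n (transpose-< (<n⇒<s² B′<n))

    not-displayed₂ : ¬ Displays T₂ a b a′ b′
    not-displayed₂ displayed = meet (find (PathBetweenLeaves.visits τpath₁ t (spineOf-mono (<⇒≤ τA<τB)) ≤-refl))
                                    (find (PathBetweenLeaves.visits τpath₂ t (spineOf-mono τA′≤τB) (spineOf-mono τB≤τB′)))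
      where
      t : ℕ
      t = spineOf (transpose B)
      τpath₁ : PathBetweenLeaves (transpose A) (transpose B) _ τB<n
      τpath₁ = pathBetweenLeaves τA<τB τB<n
      τpath₂ : PathBetweenLeaves (transpose A′) (transpose B′) _ τB′<n
      τpath₂ = pathBetweenLeaves τA′<τB′ τB′<n
      walk₁ : Walk endpoints (Transposed.leafAt a) (Transposed.leafAt b) (PathBetweenLeaves.vs τpath₁) (PathBetweenLeaves.es τpath₁)
      walk₁ = walk-cast (sym (Transposed-leaf A<n (<-trans τA<τB τB<n))) (sym (Transposed-leaf B<n τB<n)) (PathBetweenLeaves.walk τpath₁)
      walk₂ : Walk endpoints (Transposed.leafAt a′) (Transposed.leafAt b′) (PathBetweenLeaves.vs τpath₂) (PathBetweenLeaves.es τpath₂)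
      walk₂ = walk-cast (sym (Transposed-leaf A′<n (<-trans τA′<τB′ τB′<n))) (sym (Transposed-leaf B′<n τB′<n))
                        (PathBetweenLeaves.walk τpath₂)
      meet : (∃ λ v → v ∈ PathBetweenLeaves.vs τpath₁ × toℕ v ≡ n + t) →
             (∃ λ v → v ∈ PathBetweenLeaves.vs τpath₂ × toℕ v ≡ n + t) → ⊥
      meet (v₁ , v₁∈ , v₁≡) (v₂ , v₂∈ , v₂≡) =
        displayed _ _ _ _ (walk₁ , PathBetweenLeaves.unique τpath₁) (walk₂ , PathBetweenLeaves.unique τpath₂)
          v₁ v₁∈ (subst (_∈ PathBetweenLeaves.vs τpath₂) (toℕ-injective (trans v₂≡ (sym v₁≡))) v₂∈)

    in-𝒬 : InQ T₁ T₂ a b a′ b′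
    in-𝒬 = distinct , displayed₁ , not-displayed₂

  open PendantWeights c′ using (y; y-nonNeg; y-pendant; y-spine; leaf-walk-≥½)

  y-feasible : LPFeasible T₁ T₂ y
  y-feasible = y-nonNeg , λ a b c d (distinct , _) _ _ _ _ (w₁ , _) (w₂ , _) →
    ℚ.+-mono-≤ (leaf-walk-≥½ w₁ (leaf≢ (proj₁ distinct)) (leaf<n a) (leaf<n b))
               (leaf-walk-≥½ w₂ (leaf≢ (proj₂ (proj₂ (proj₂ (proj₂ (proj₂ distinct)))))) (leaf<n c) (leaf<n d))
    where
    leaf≢ : ∀ {i j} → i ≢ j → Ordered.leafAt i ≢ Ordered.leafAt j
    leaf≢ {i} {j} i≢j eq = i≢j (Ordered.leafAt-injective i j eq)
    leaf<n : ∀ i → toℕ (Ordered.leafAt i) < n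
    leaf<n i = subst (_< n) (sym (Ordered.toℕ-leafAt i)) (toℕ<n i)

  count-pendants : count (λ i → does (i <? n)) #E ≡ n
  count-pendants = begin
      count (λ i → does (i <? n)) (n + c)
    ≡⟨ Σ<-split (λ i → 𝟙 (does (i <? n))) n c ⟩
      count (λ i → does (i <? n)) n + count (λ t → does (n + t <? n)) c
    ≡⟨ cong₂ _+_ (trans (Σ<-cong n (λ i i<n → cong 𝟙 (dec-true (i <? n) i<n))) (Σ<-const-1 n))
                 (Σ<-zero c (λ t _ → cong 𝟙 (dec-false (n + t <? n) (λ lt → <⇒≱ lt (m≤m+n n t))))) ⟩
      n + 0
    ≡⟨ +-identityʳ n ⟩
      n ∎
    where open ≡-Reasoning

  objective-y : objective T₁ y ≡ ¼ ℚ.* fromℕ n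
  objective-y = begin
      sumℚ (map y (tabulate id))
    ≡⟨ cong sumℚ (map-tabulate id y) ⟩
      sumℚ (tabulate y)
    ≡⟨ sumℚ-tabulate y ¼ (λ i → does (i <? n)) y≡ ⟩
      ¼ ℚ.* fromℕ (count (λ i → does (i <? n)) #E)
    ≡⟨ cong (λ k → ¼ ℚ.* fromℕ k) count-pendants ⟩
      ¼ ℚ.* fromℕ n ∎
    where
    open ≡-Reasoning
    y≡ : ∀ e → y e ≡ ¼ ℚ.* fromℕ (𝟙 (does (toℕ e <? n)))
    y≡ e with n ≤? toℕ e
    ... | no n≰e = trans (y-pendant e (≰⇒> n≰e)) (cong (λ b → ¼ ℚ.* fromℕ (𝟙 b)) (sym (dec-true (toℕ e <? n) (≰⇒> n≰e))))
    ... | yes n≤e = trans (y-spine e n≤e) (cong (λ b → ¼ ℚ.* fromℕ (𝟙 b)) (sym (dec-false (toℕ e <? n) (≤⇒≯ n≤e))))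

  module IntegralSolution (x : Fin #E → ℚ) (x-feasible : IPFeasible T₁ T₂ x) where

    isOne : ℚ → Bool
    isOne q = does (q ℚ.≟ 1ℚ)

    chosen : ℕ → Bool
    chosen i with i <? #E
    ... | yes h = isOne (x (fromℕ< h))
    ... | no _ = false

    chosen-edge : ∀ e → chosen (toℕ e) ≡ isOne (x e)
    chosen-edge e with toℕ e <? #E
    ... | yes h = cong (λ f → isOne (x f)) (fromℕ<-toℕ e h)
    ... | no e≮#E = ⊥-elim (e≮#E (toℕ<n e))

    x≡𝟙 : ∀ e → x e ≡ fromℕ (𝟙 (chosen (toℕ e)))
    x≡𝟙 e = trans (0/1≡𝟙 (proj₁ x-feasible e)) (cong (λ b → fromℕ (𝟙 b)) (sym (chosen-edge e)))
      where
      0/1≡𝟙 : ∀ {q} → q ≡ 0ℚ ⊎ q ≡ 1ℚ → q ≡ fromℕ (𝟙 (isOne q))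
      0/1≡𝟙 (inj₁ refl) = refl
      0/1≡𝟙 (inj₂ refl) = refl

    unchosen⇒zero : ∀ {e} → chosen (toℕ e) ≡ false → x e ≡ 0ℚ
    unchosen⇒zero {e} Xe = trans (x≡𝟙 e) (cong (λ b → fromℕ (𝟙 b)) Xe)

    -- leaves 0 and 1 form a cherry; the spine edge t — t + 1 separates leaves ≤ t + 1 from the rest
    gap : ℕ → Bool
    gap zero = false
    gap (suc t) = chosen (n + t)

    open FreePairs s chosen gap

    free⇒path-zero : ∀ {j k} (j<k : j < k) (k<n : k < n) → Free j k →
                     All (λ e → x e ≡ 0ℚ) (PathBetweenLeaves.es (pathBetweenLeaves j<k k<n))
    free⇒path-zero {j} {k} j<k k<n (pj , pk , gaps) = All.map on-path (PathBetweenLeaves.uses (pathBetweenLeaves j<k k<n))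
      where
      on-path : ∀ {e} → toℕ e ≡ j ⊎ toℕ e ≡ k ⊎ (n + spineOf j ≤ toℕ e × toℕ e < n + spineOf k) → x e ≡ 0ℚ
      on-path (inj₁ refl) = unchosen⇒zero pj
      on-path (inj₂ (inj₁ refl)) = unchosen⇒zero pk
      on-path {e} (inj₂ (inj₂ (lo , hi))) =
        unchosen⇒zero (trans (cong chosen (sym e≡)) (gaps (<spineOf⇒suc< t<) (≤spineOf⇒≤suc j≤1+c ≤t)))
        where
        t : ℕ
        t = toℕ e ∸ n
        e≡ : n + t ≡ toℕ e
        e≡ = m+[n∸m]≡n (≤-trans (m≤m+n n (spineOf j)) lo)
        ≤t : spineOf j ≤ t
        ≤t = +-cancelˡ-≤ n _ _ (subst (n + spineOf j ≤_) (sym e≡) lo)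
        t< : t < spineOf k
        t< = +-cancelˡ-< n _ _ (subst (_< n + spineOf k) (sym e≡) hi)
        j≤1+c : j ≤ suc c
        j≤1+c = s≤s⁻¹ (s≤s⁻¹ (≤-trans (s≤s j<k) k<n))

    sum-zero : ∀ es → All (λ e → x e ≡ 0ℚ) es → sumℚ (map x es) ≡ 0ℚ
    sum-zero [] [] = refl
    sum-zero (e ∷ es) (xe ∷ xes) rewrite xe | sum-zero es xes = refl

    no-crossing : NoCrossing
    no-crossing r<r′ r′<s j<s (i , i<j , free) (i′ , i′<j , free′) = 1≰0 (subst (1ℚ ℚ.≤_) both-zero covered)
      where
      open Quartet r<r′ r′<s i<j i′<j j<s
      covered : 1ℚ ℚ.≤ sumℚ (map x (PathBetweenLeaves.es path₁)) ℚ.+ sumℚ (map x (PathBetweenLeaves.es path₂))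
      covered = proj₂ x-feasible a b a′ b′ in-𝒬 _ _ _ _ ordered-path₁ ordered-path₂
      both-zero : sumℚ (map x (PathBetweenLeaves.es path₁)) ℚ.+ sumℚ (map x (PathBetweenLeaves.es path₂)) ≡ 0ℚ
      both-zero = cong₂ ℚ._+_ (sum-zero _ (free⇒path-zero A<B B<n free)) (sum-zero _ (free⇒path-zero A′<B′ B′<n free′))
      1≰0 : ¬ (1ℚ ℚ.≤ 0ℚ)
      1≰0 (ℚ.*≤* (ℤ.+≤+ ()))

    chosen-beyond : ∀ {i} → ¬ i < #E → chosen i ≡ false
    chosen-beyond {i} i≮#E with i <? #E
    ... | yes i<#E = ⊥-elim (i≮#E i<#E)
    ... | no _ = refl

    count-pendants+gaps : count chosen n + count gap (suc (suc c)) ≡ count chosen #E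
    count-pendants+gaps = begin
        count chosen n + count (λ t → chosen (n + t)) (suc c)
      ≡⟨ cong (count chosen n +_) (count-last (λ t → chosen (n + t)) c) ⟩
        count chosen n + (count (λ t → chosen (n + t)) c + 𝟙 (chosen (n + c)))
      ≡⟨ cong (λ b → count chosen n + (count (λ t → chosen (n + t)) c + 𝟙 b)) (chosen-beyond (<-irrefl refl)) ⟩
        count chosen n + (count (λ t → chosen (n + t)) c + 0)
      ≡⟨ cong (count chosen n +_) (+-identityʳ _) ⟩
        count chosen n + count (λ t → chosen (n + t)) c
      ≡⟨ Σ<-split (λ i → 𝟙 (chosen i)) n c ⟨
        count chosen #E ∎
      where open ≡-Reasoning

    n≤chosen+2s+2 : n ≤ count chosen #E + (s + s + 2)
    n≤chosen+2s+2 = subst (n ≤_) (trans (cong (λ k → k + (s + s) + 2) count-pendants+gaps) (+-assoc (count chosen #E) (s + s) 2))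
                    (count-bound no-crossing (suc (suc c)) n≡s²)

    objective-x : objective T₁ x ≡ fromℕ (count chosen #E)
    objective-x = begin
        sumℚ (map x (tabulate id))
      ≡⟨ cong sumℚ (map-tabulate id x) ⟩
        sumℚ (tabulate x)
      ≡⟨ sumℚ-tabulate x 1ℚ chosen (λ e → trans (x≡𝟙 e) (sym (ℚ.*-identityˡ _))) ⟩
        1ℚ ℚ.* fromℕ (count chosen #E)
      ≡⟨ ℚ.*-identityˡ _ ⟩
        fromℕ (count chosen #E) ∎
      where open ≡-Reasoning

  𝒬-nonempty : ∃ λ a → ∃ λ b → ∃ λ c → ∃ λ d → InQ T₁ T₂ a b c d
  𝒬-nonempty = a , b , a′ , b′ , in-𝒬
    where
    1<s : 1 < s
    1<s = 2≤s
    open Quartet {0} {1} {0} {0} {1} z<s 1<s z<s z<s 1<s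

  integrality-gap : ∀ ε → fromℕ (s + s + 2) ℚ.≤ ε ℚ.* (¼ ℚ.* fromℕ (s * s)) →
                    ∀ x → IPFeasible T₁ T₂ x → ((ℤ.+ 4) ℚ./ 1 ℚ.- ε) ℚ.* objective T₁ y ℚ.≤ objective T₁ x
  integrality-gap ε slack x x-feasible =
    subst₂ (λ u v → ((ℤ.+ 4) ℚ./ 1 ℚ.- ε) ℚ.* u ℚ.≤ v) (sym objective-y) (sym objective-x)
           (ratio-bound ε (count chosen #E) n (s + s + 2) n≤chosen+2s+2
                        (subst (λ k → fromℕ (s + s + 2) ℚ.≤ ε ℚ.* (¼ ℚ.* fromℕ k)) (sym n≡s²) slack))
    where open IntegralSolution x x-feasible

open import Defs
open import Data.Nat using (ℕ)
open import Data.Fin using (Fin)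
open import Data.Product using (Σ; ∃; _×_; _,_)
open import Data.Rational using (ℚ; _<_; _≤_; _*_; _-_; 0ℚ; _/_)
open import Data.Integer using (+_)

import Data.Nat.Properties as ℕ
open import Data.Integer using (+[1+_]; -[1+_]; +<+)
open import Data.Rational using (mkℚ; *<*)
open import Relation.Binary.PropositionalEquality using (refl; sym; subst)
open RationalBounds using (fromℕ; ¼; 1≤positive*denominator; slack-bound)

theorem9 : (ε : ℚ) → 0ℚ < ε → (N : ℕ) →
    Σ ℕ λ n → N Data.Nat.≤ n × Σ (BinPhyloTree n) λ T₁ → Σ (BinPhyloTree n) λ T₂ →
      (∃ λ a → ∃ λ b → ∃ λ c → ∃ λ d → InQ T₁ T₂ a b c d) ×
      (Σ (Fin (m T₁) → ℚ) λ y → LPFeasible T₁ T₂ y ×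
        ((x : Fin (m T₁) → ℚ) → IPFeasible T₁ T₂ x →
          ((+ 4) / 1 - ε) * objective T₁ y ≤ objective T₁ x))
theorem9 ε@(mkℚ +[1+ p ] q-1 coprime) _ N =
  n , N≤n , T₁ , T₂ , 𝒬-nonempty , y , y-feasible , integrality-gap ε slack
  where
  w s : ℕ
  w = 3 ℕ.+ N
  s = 4 ℕ.* ℕ.suc q-1 ℕ.* w
  2≤s : 2 ℕ.≤ s
  2≤s = ℕ.≤-trans (ℕ.m≤m+n 2 2) (ℕ.≤-trans (ℕ.m≤m*n 4 (ℕ.suc q-1)) (ℕ.m≤m*n (4 ℕ.* ℕ.suc q-1) w))
  open Construction s 2≤s
  open Caterpillar c′ using (n)
  open PendantWeights c′ using (y)
  N≤n : N ℕ.≤ n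
  N≤n = subst (N ℕ.≤_) (sym n≡s²) (ℕ.≤-trans (ℕ.≤-trans (ℕ.m≤n+m N 3) (ℕ.m≤n*m w (4 ℕ.* ℕ.suc q-1))) (ℕ.m≤m*n s s))
  slack : fromℕ (s ℕ.+ s ℕ.+ 2) ≤ ε * (¼ * fromℕ (s ℕ.* s))
  slack = slack-bound ε (ℕ.suc q-1) w s (1≤positive*denominator p q-1 coprime) refl (ℕ.m≤m+n 3 N) 2≤s
theorem9 (mkℚ (+ 0) _ _) (*<* (+<+ ())) _
theorem9 (mkℚ -[1+ _ ] _ _) (*<* ()) _
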